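{- Let $G$ be a graph and $X,Y$ disjoint subsets of $V(G)$. Let $r,\ell,t\in\mathbb{N}$ with $r\geqslant 3$, $\alpha>0$, and $T_1,\dots,T_\ell$ trees. If $C\geqslant 2^{\ell+3}\alpha^{ -1}\sum_{i=1}^\ell|T_i|$ and some $S\in\mathcal{F}^{r,t}_\ell(Y)$ is $(r,\ell,t,C,\alpha)$-good for $(X,Y)$, then $G$ contains a copy of $Z^{r,t}_\ell(T_1,\dots,T_\ell)$.
   Context: Notation: $[\ell]=\{1,\dots,\ell\}$; $N(v)$ is the neighbourhood of $v$; $E(X)$ is the set of edges of $G$ with both ends in $X$; for a set $D$ of edges, $\overline{d}(D)$ is the average degree of the graph on the endpoints of $D$ with edge set $D$. Modified Zykov graph: for disjoint trees $T_1,\dots,T_\ell$, $T_j$ with bipartition $A_j\cup B_j$, $Z_\ell(T_1,\dots,T_\ell)$ has vertices $\bigcup_j(A_j\cup B_j)\cup\{u_I:I\subseteq[\ell]\}$, the edges of all $T_j$, and $u_I$ joined to all of $A_j$ if $j\in I$ and to all of $B_j$ if $j\notin I$. $Z^{r,t}_\ell(T_1,\dots,T_\ell)$ is obtained by adding vertices $w_1,\dots,w_{r-3}$ adjacent to all other vertices and to each other, then blowing up each $u_I$ and each $w_j$ into an independent set of size $t$ (each edge at a blown-up vertex replaced by a complete bipartite graph). For $Y\subseteq V(G)$, $\mathcal{F}^{r,t}_\ell(Y)$ is the set of functions $S$ assigning to each $I\subseteq[\ell]$ a $t$-set $S_I\subseteq Y$ and to each $j\in[r-3]$ a $t$-set $S'_j\subseteq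 Y$, such that all these sets are pairwise disjoint, each $S_I$ is completely joined to each $S'_j$, and $S'_j$ is completely joined to $S'_{j'}$ for $j\neq j'$. For an ordered pair $(x,y)$ and $i\in[\ell]$, $(x,y)\to_i S$ means $S'_j\subseteq N(x)\cap N(y)$ for all $j$, $S_I\subseteq N(x)$ for all $I\ni i$, $S_I\subseteq N(y)$ for all $I\not\ni i$; for an edge $e=xy$, $e\to_iS$ means $(x,y)\to_iS$ or $(y,x)\to_iS$; $(e_1,\dots,e_\ell)\to S$ means $e_i\to_iS$ for all $i$. $S$ is $(r,\ell,t,C,\alpha)$-good for $(X,Y)$ if there exist $E_1,\dots,E_\ell\subseteq E(X)$ with $\overline{d}(E_j)\geqslant 2^{ -\ell}\alpha C$ for each $j$ such that $(e_1,\dots,e_\ell)\to S$ for all $e_1\in E_1,\dots,e_\ell\in E_\ell$.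
   Formalization: The parameters α and C range over the rationals. -}

module Defs where

open import Data.Nat as ℕ using (ℕ; zero; suc; _+_; _∸_; _^_)
open import Data.Nat.Properties using (m^n≢0)
open import Data.Nat.ListAction using (sum)
open import Data.Integer using (+_)
open import Data.Rational as ℚ using (ℚ; 0ℚ; _/_; _*_; _≤_; _>_; 1/_; >-nonZero)
open import Data.Fin using (Fin; suc; zero)
open import Data.Fin.Subset using (Subset; _∈_; _∉_; _⊆_; ∣_∣)
open import Data.Bool using (Bool; true; false)
open import Data.List using (List; tabulate)
open import Data.Product using (Σ; _×_; _,_; ∃)
open import Data.Sum using (_⊎_)
open import Data.Empty using (⊥)
open import Relation.Nullary using (¬_)
open import Relation.Binary.PropositionalEquality using (_≡_; _≢_)

record Graph (n : ℕ) : Set₁ where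
  field
    Adj   : Fin n → Fin n → Set
    sym   : ∀ {x y} → Adj x y → Adj y x
    irrefl : ∀ {x} → ¬ Adj x x
open Graph public

data Walk {m : ℕ} (R : Fin m → Fin m → Set) : Fin m → Fin m → Set where
  here : ∀ {x} → Walk R x x
  step : ∀ {x y z} → R x y → Walk R y z → Walk R x z

-- a cycle of length k+3: an injective cyclic sequence of adjacent vertices
record Cycle {m : ℕ} (R : Fin m → Fin m → Set) : Set where
  field
    k      : ℕ
    vtx    : Fin (suc (suc (suc k))) → Fin m
    inj    : ∀ i j → vtx i ≡ vtx j → i ≡ j
    adjSuc : ∀ (i : Fin (suc (suc k))) → R (vtx (Data.Fin.inject₁ i)) (vtx (suc i))
    closes : R (vtx (Data.Fin.fromℕ (suc (suc k)))) (vtx zero)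

record Tree : Set₁ where
  field
    size      : ℕ
    nonempty  : 0 ℕ.< size
    Adj       : Fin size → Fin size → Set
    sym       : ∀ {x y} → Adj x y → Adj y x
    irrefl    : ∀ {x} → ¬ Adj x x
    connected : ∀ x y → Walk Adj x y
    acyclic   : ¬ Cycle Adj
    -- bipartition: inA v ≡ true means v ∈ A, otherwise v ∈ B
    inA       : Fin size → Bool
    bip       : ∀ {x y} → Adj x y → ¬ (inA x ≡ inA y)
open Tree public

data ZV (r ℓ t : ℕ) (T : Fin ℓ → Tree) : Set where
  tv : (j : Fin ℓ) → Fin (size (T j)) → ZV r ℓ t T
  uv : Subset ℓ → Fin t → ZV r ℓ t T
  wv : Fin (r ∸ 3) → Fin t → ZV r ℓ t T

UAdj : ∀ {ℓ} (T : Fin ℓ → Tree) → Subset ℓ → (j : Fin ℓ) → Fin (size (T j)) → Set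
UAdj T I j v = (j ∈ I × inA (T j) v ≡ true) ⊎ (j ∉ I × inA (T j) v ≡ false)

data ZAdj {r ℓ t : ℕ} {T : Fin ℓ → Tree} : ZV r ℓ t T → ZV r ℓ t T → Set where
  tt-adj : ∀ {j v v'} → Adj (T j) v v' → ZAdj (tv j v) (tv j v')
  ut-adj : ∀ {I a j v} → UAdj T I j v → ZAdj (uv I a) (tv j v)
  tu-adj : ∀ {I a j v} → UAdj T I j v → ZAdj (tv j v) (uv I a)
  wt-adj : ∀ {i a j v} → ZAdj (wv i a) (tv j v)
  tw-adj : ∀ {i a j v} → ZAdj (tv j v) (wv i a)
  wu-adj : ∀ {i a I b} → ZAdj (wv i a) (uv I b)
  uw-adj : ∀ {i a I b} → ZAdj (uv I b) (wv i a)
  ww-adj : ∀ {i a i' b} → i ≢ i' → ZAdj (wv i a) (wv i' b)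

ContainsZ : ∀ {n} → Graph n → (r ℓ t : ℕ) → (Fin ℓ → Tree) → Set
ContainsZ G r ℓ t T =
  Σ (ZV r ℓ t T → Fin _) λ f →
    (∀ a b → f a ≡ f b → a ≡ b) ×
    (∀ a b → ZAdj a b → Adj G (f a) (f b))

record EdgeSetIn {n} (G : Graph n) (X : Subset n) : Set where
  field
    mem   : Fin n → Fin n → Bool
    msym  : ∀ x y → mem x y ≡ mem y x
    sound : ∀ x y → mem x y ≡ true → Adj G x y × x ∈ X × y ∈ X
open EdgeSetIn public

count : ∀ {n} → (Fin n → Bool) → ℕ
count {zero} p = 0
count {suc n} p with p zero
... | true  = suc (count (λ i → p (suc i)))
... | false = count (λ i → p (suc i))

any : ∀ {n} → (Fin n → Bool) → Bool
any {zero} p = false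
any {suc n} p with p zero
... | true  = true
... | false = any (λ i → p (suc i))

degE : ∀ {n} {G : Graph n} {X} → EdgeSetIn G X → Fin n → ℕ
degE D x = count (mem D x)

vertsE : ∀ {n} {G : Graph n} {X} → EdgeSetIn G X → ℕ
vertsE D = count (λ x → any (mem D x))

sumF : ∀ {n} → (Fin n → ℕ) → ℕ
sumF f = sum (tabulate f)

-- average degree  d̄(D) = (Σ_x deg_D x) / |V(D)|  (= 2|D|/|V(D)|); 0 for empty D
avgDeg : ∀ {n} {G : Graph n} {X} → EdgeSetIn G X → ℚ
avgDeg {n} D with vertsE D
... | zero  = 0ℚ
... | suc k = (+ sumF (degE D)) / suc k

record Family (n r ℓ : ℕ) : Set where
  field
    SI : Subset ℓ → Subset n
    SW : Fin (r ∸ 3) → Subset n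
open Family public

Disj : ∀ {n} → Subset n → Subset n → Set
Disj A B = ∀ x → x ∈ A → x ∈ B → ⊥

Joined : ∀ {n} → Graph n → Subset n → Subset n → Set
Joined G A B = ∀ x y → x ∈ A → y ∈ B → Adj G x y

InF : ∀ {n} (G : Graph n) (r ℓ t : ℕ) (Y : Subset n) → Family n r ℓ → Set
InF G r ℓ t Y S =
  (∀ I → ∣ SI S I ∣ ≡ t) × (∀ j → ∣ SW S j ∣ ≡ t) ×
  (∀ I → SI S I ⊆ Y) × (∀ j → SW S j ⊆ Y) ×
  (∀ I I' → I ≢ I' → Disj (SI S I) (SI S I')) ×
  (∀ j j' → j ≢ j' → Disj (SW S j) (SW S j')) ×
  (∀ I j → Disj (SI S I) (SW S j)) ×
  (∀ I j → Joined G (SI S I) (SW S j)) ×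
  (∀ j j' → j ≢ j' → Joined G (SW S j) (SW S j'))

InNbhd : ∀ {n} → Graph n → Subset n → Fin n → Set
InNbhd G A x = ∀ z → z ∈ A → Adj G x z

PairTo : ∀ {n r ℓ} → Graph n → Fin ℓ → Fin n → Fin n → Family n r ℓ → Set
PairTo G i x y S =
  (∀ j → InNbhd G (SW S j) x × InNbhd G (SW S j) y) ×
  (∀ I → i ∈ I → InNbhd G (SI S I) x) ×
  (∀ I → i ∉ I → InNbhd G (SI S I) y)

EdgeTo : ∀ {n r ℓ} → Graph n → Fin ℓ → Fin n → Fin n → Family n r ℓ → Set
EdgeTo G i x y S = PairTo G i x y S ⊎ PairTo G i y x S

twoPowNeg : ℕ → ℚ
twoPowNeg ℓ = (+ 1) / (2 ^ ℓ) where instance _ = m^n≢0 2 ℓ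

invPos : (α : ℚ) → α > 0ℚ → ℚ
invPos α p = 1/_ α {{>-nonZero p}}

ℕtoℚ : ℕ → ℚ
ℕtoℚ k = (+ k) / 1

Good : ∀ {n} (G : Graph n) (r ℓ t : ℕ) (C α : ℚ) (X Y : Subset n) → Family n r ℓ → Set
Good G r ℓ t C α X Y S =
  Σ (Fin ℓ → EdgeSetIn G X) λ E →
    (∀ j → twoPowNeg ℓ * α * C ≤ avgDeg (E j)) ×
    (∀ (x y : Fin ℓ → Fin _) → (∀ i → mem (E i) (x i) (y i) ≡ true) →
       ∀ i → EdgeTo G i (x i) (y i) S)

module Submission where

-- Let s = Σ|T_i|. Each edge set E_j witnessing goodness has average degree
-- ≥ 2^{-ℓ} α C ≥ 8s, so it is nonempty with degree sum ≥ 8s|V(E_j)| (AverageDegree).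
-- Fixing one edge of every E_j, goodness shows that every single edge vu of E_j
-- satisfies vu →ⱼ S; orienting each edge accordingly gives more than 2s|V(E_j)|
-- arcs (Orientations, OrientedHosts). Deleting vertices of degree < s from the
-- bipartite double cover of these arcs leaves a nonempty "host" of minimum degree
-- ≥ s (DenseSubgraphs, DoubleCover). Trees embed greedily into a host while
-- avoiding few forbidden vertices, as in a tree each new vertex has a single
-- embedded neighbour (TreePaths, BipartiteHosts); hence T₁,…,T_ℓ embed disjointly
-- into the hosts of E₁,…,E_ℓ, with A_j at tails and B_j at heads of arcs. These
-- copies lie in X and are joined to the right sets S_I and S'_i, and with
-- enumerations of the t-sets of S they form the copy of Z^{r,t}_ℓ (ZykovCopies).

module Counting where

  open import Defs hiding (sym)
  open import Data.Nat using (ℕ; zero; suc; _+_; _*_; _≤_; _<_; z≤n; s≤s; s≤s⁻¹)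
  open import Data.Nat.Properties hiding (_≟_)
  open import Data.Bool using (Bool; true; false; _∧_; _∨_; not)
  open import Data.Bool.Properties using (∧-identityʳ; ∨-identityʳ; ∨-zeroʳ; not-¬)
  open import Data.Empty using (⊥-elim)
  open import Data.Fin using (Fin; zero; suc; _↑ˡ_; _↑ʳ_; splitAt; _≟_)
  open import Data.Fin.Properties using (splitAt-↑ˡ; splitAt-↑ʳ)
  open import Data.Product using (Σ; _×_; _,_)
  open import Data.Sum using (_⊎_; inj₁; inj₂)
  open import Function using (_∘_)
  open import Relation.Nullary using (does; yes)
  open import Relation.Nullary.Decidable using (dec-true)
  open import Relation.Binary.PropositionalEquality
  open import Algebra.Properties.CommutativeMonoid.Sum +-0-commutativeMonoid
    using (sum; sum-cong-≗; sum-replicate-zero)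

  𝟙 : Bool → ℕ
  𝟙 true  = 1
  𝟙 false = 0

  𝟙≤1 : ∀ b → 𝟙 b ≤ 1
  𝟙≤1 true  = s≤s z≤n
  𝟙≤1 false = z≤n

  𝟙-∧ : ∀ a b → 𝟙 a * 𝟙 b ≡ 𝟙 (a ∧ b)
  𝟙-∧ true  true  = refl
  𝟙-∧ true  false = refl
  𝟙-∧ false b     = refl

  card : ∀ {N} → (Fin N → Bool) → ℕ
  card P = sum (𝟙 ∘ P)

  sumF≡sum : ∀ {N} (f : Fin N → ℕ) → sumF f ≡ sum f
  sumF≡sum {zero}  f = refl
  sumF≡sum {suc N} f = cong (f zero +_) (sumF≡sum (f ∘ suc))

  count≡card : ∀ {N} (P : Fin N → Bool) → count P ≡ card P
  count≡card {zero}  P = refl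
  count≡card {suc N} P with P zero
  ... | true  = cong suc (count≡card (P ∘ suc))
  ... | false = count≡card (P ∘ suc)

  sum-mono : ∀ {N} {f g : Fin N → ℕ} → (∀ i → f i ≤ g i) → sum f ≤ sum g
  sum-mono {zero}  f≤g = z≤n
  sum-mono {suc N} f≤g = +-mono-≤ (f≤g zero) (sum-mono (f≤g ∘ suc))

  sum-zero : ∀ {N} {f : Fin N → ℕ} → (∀ i → f i ≡ 0) → sum f ≡ 0
  sum-zero {N} f≡0 = trans (sum-cong-≗ f≡0) (sum-replicate-zero N)

  term≤sum : ∀ {N} (f : Fin N → ℕ) i → f i ≤ sum f
  term≤sum f zero    = m≤m+n _ _
  term≤sum f (suc i) = ≤-trans (term≤sum (f ∘ suc) i) (m≤n+m _ _)

  sum-↑ : ∀ N {M} (f : Fin (N + M) → ℕ) → sum f ≡ sum (λ i → f (i ↑ˡ M)) + sum (λ i → f (N ↑ʳ i))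
  sum-↑ zero    f = refl
  sum-↑ (suc N) f = trans (cong (f zero +_) (sum-↑ N (f ∘ suc))) (sym (+-assoc (f zero) _ _))

  sum-splitAt : ∀ N (g : Fin N ⊎ Fin N → ℕ) → sum (g ∘ splitAt N) ≡ sum (g ∘ inj₁) + sum (g ∘ inj₂)
  sum-splitAt N g = trans (sum-↑ N (g ∘ splitAt N))
    (cong₂ _+_ (sum-cong-≗ (λ v → cong g (splitAt-↑ˡ N v N))) (sum-cong-≗ (λ u → cong g (splitAt-↑ʳ N N u))))

  card≤ : ∀ {N} (P : Fin N → Bool) → card P ≤ N
  card≤ {zero}  P = z≤n
  card≤ {suc N} P = +-mono-≤ (𝟙≤1 (P zero)) (card≤ (P ∘ suc))

  card-full : ∀ {N} (P : Fin N → Bool) → (∀ i → P i ≡ true) → card P ≡ N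
  card-full {zero}  P all = refl
  card-full {suc N} P all rewrite all zero = cong suc (card-full (P ∘ suc) (all ∘ suc))

  card< : ∀ {N} (P : Fin N → Bool) z → P z ≡ false → card P < N
  card< {suc N} P zero    Pz rewrite Pz = s≤s (card≤ (P ∘ suc))
  card< {suc N} P (suc z) Pz = begin-strict
      𝟙 (P zero) + card (P ∘ suc)  <⟨ +-monoʳ-< (𝟙 (P zero)) (card< (P ∘ suc) z Pz) ⟩
      𝟙 (P zero) + N               ≤⟨ +-monoˡ-≤ N (𝟙≤1 (P zero)) ⟩
      suc N                        ∎
    where open ≤-Reasoning

  pigeonhole : ∀ {N} (P Q : Fin N → Bool) → card Q < card P → Σ (Fin N) λ x → P x ≡ true × Q x ≡ false
  pigeonhole {suc N} P Q lt with P zero in Pz | Q zero in Qz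
  ... | true  | false = zero , Pz , Qz
  ... | false | false = let (x , Px , Qx) = pigeonhole (P ∘ suc) (Q ∘ suc) lt in suc x , Px , Qx
  ... | false | true  = let (x , Px , Qx) = pigeonhole (P ∘ suc) (Q ∘ suc) (<-trans (n<1+n _) lt) in suc x , Px , Qx
  ... | true  | true  = let (x , Px , Qx) = pigeonhole (P ∘ suc) (Q ∘ suc) (s≤s⁻¹ lt) in suc x , Px , Qx

  witness : ∀ {N} (P : Fin N → Bool) → 0 < card P → Σ (Fin N) λ x → P x ≡ true
  witness {N} P pos with pigeonhole P (λ _ → false) (subst (_< card P) (sym (sum-zero {N} (λ _ → refl))) pos)
  ... | x , Px , _ = x , Px

  insert : ∀ {N} → (Fin N → Bool) → Fin N → Fin N → Bool
  insert P z y = P y ∨ does (y ≟ z)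

  remove : ∀ {N} → (Fin N → Bool) → Fin N → Fin N → Bool
  remove P x y = P y ∧ not (does (y ≟ x))

  insert-old : ∀ {N} (P : Fin N → Bool) z {a} → P a ≡ true → insert P z a ≡ true
  insert-old P z Pa rewrite Pa = refl

  insert-new : ∀ {N} (P : Fin N → Bool) z → insert P z z ≡ true
  insert-new P z rewrite dec-true (z ≟ z) refl = ∨-zeroʳ (P z)

  insert-cases : ∀ {N} (P : Fin N → Bool) z a → insert P z a ≡ true → P a ≡ true ⊎ a ≡ z
  insert-cases P z a _ with P a | a ≟ z
  ... | true  | _       = inj₁ refl
  ... | false | yes a≡z = inj₂ a≡z

  card-insert : ∀ {N} (P : Fin N → Bool) z → P z ≡ false → card (insert P z) ≡ suc (card P)
  card-insert {suc N} P zero Pz rewrite Pz =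
    cong suc (sum-cong-≗ (λ i → cong 𝟙 (∨-identityʳ (P (suc i)))))
  card-insert {suc N} P (suc z) Pz =
    trans (cong₂ _+_ (cong 𝟙 (∨-identityʳ (P zero))) (card-insert (P ∘ suc) z Pz)) (+-suc (𝟙 (P zero)) _)

  remove≤ : ∀ {N} (P : Fin N → Bool) x y → 𝟙 (remove P x y) ≤ 𝟙 (P y)
  remove≤ P x y with P y
  ... | true  = 𝟙≤1 _
  ... | false = z≤n

  sum-remove : ∀ {N} (P : Fin N → Bool) x (g : Fin N → ℕ) → P x ≡ true →
    sum (λ y → 𝟙 (P y) * g y) ≡ sum (λ y → 𝟙 (remove P x y) * g y) + g x
  sum-remove {suc N} P zero g Px rewrite Px = begin
      g zero + 0 + sum (λ i → 𝟙 (P (suc i)) * g (suc i))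
    ≡⟨ cong₂ _+_ (+-identityʳ (g zero)) (sum-cong-≗ (λ i → cong (λ b → 𝟙 b * g (suc i)) (sym (∧-identityʳ (P (suc i)))))) ⟩
      g zero + sum (λ i → 𝟙 (remove P zero (suc i)) * g (suc i))
    ≡⟨ +-comm (g zero) _ ⟩
      sum (λ i → 𝟙 (remove P zero (suc i)) * g (suc i)) + g zero
    ∎
    where open ≡-Reasoning
  sum-remove {suc N} P (suc x) g Px = begin
      𝟙 (P zero) * g zero + sum (λ i → 𝟙 (P (suc i)) * g (suc i))
    ≡⟨ cong (𝟙 (P zero) * g zero +_) (sum-remove (P ∘ suc) x (g ∘ suc) Px) ⟩
      𝟙 (P zero) * g zero + (sum (λ i → 𝟙 (remove P (suc x) (suc i)) * g (suc i)) + g (suc x))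
    ≡⟨ sym (+-assoc (𝟙 (P zero) * g zero) _ _) ⟩
      𝟙 (P zero) * g zero + sum (λ i → 𝟙 (remove P (suc x) (suc i)) * g (suc i)) + g (suc x)
    ≡⟨ cong (λ b → 𝟙 b * g zero + sum (λ i → 𝟙 (remove P (suc x) (suc i)) * g (suc i)) + g (suc x))
            (sym (∧-identityʳ (P zero))) ⟩
      sum (λ y → 𝟙 (remove P (suc x) y) * g y) + g (suc x)
    ∎
    where open ≡-Reasoning

  ∧-true : ∀ {a b} → a ∧ b ≡ true → a ≡ true × b ≡ true
  ∧-true {true} b≡true = refl , b≡true

  𝟙-∧≤ : ∀ a b → 𝟙 (a ∧ b) ≤ 𝟙 a
  𝟙-∧≤ true  b = 𝟙≤1 b
  𝟙-∧≤ false b = z≤n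

  any-intro : ∀ {N} (P : Fin N → Bool) x → P x ≡ true → any P ≡ true
  any-intro {suc N} P x Px with P zero in P0
  ... | true = refl
  any-intro {suc N} P zero    Px | false = ⊥-elim (not-¬ Px P0)
  any-intro {suc N} P (suc x) Px | false = any-intro (P ∘ suc) x Px

  any-elim : ∀ {N} (P : Fin N → Bool) → any P ≡ true → Σ (Fin N) λ x → P x ≡ true
  any-elim {suc N} P anyP with P zero in P0
  ... | true  = zero , P0
  ... | false = let (x , Px) = any-elim (P ∘ suc) anyP in suc x , Px

  someEdge : ∀ {n} {G : Graph n} {X} (D : EdgeSetIn G X) → 0 < vertsE D → Σ (Fin n) λ x → Σ (Fin n) λ y → mem D x y ≡ true
  someEdge D spans with witness (λ x → any (mem D x)) (subst (0 <_) (count≡card (λ x → any (mem D x))) spans)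
  ... | x , x-spanned = x , any-elim (mem D x) x-spanned

  arcCount : ∀ {n} → (Fin n → Fin n → Bool) → ℕ
  arcCount A = sum (λ v → sum (λ u → 𝟙 (A v u)))


module TreePaths where

  open import Defs using (Walk; here; step; Cycle)
  open import Data.Nat using (ℕ; zero; suc)
  open import Data.Fin using (Fin; zero; suc; inject₁; fromℕ; _≟_)
  open import Data.List using (List; []; _∷_)
  open import Data.List.Relation.Unary.Any using (here; there)
  open import Data.List.Membership.Propositional using (_∈_; _∉_)
  open import Data.List.Relation.Unary.Unique.Propositional using (Unique; []; _∷_)
  open import Data.Product using (Σ; _×_; _,_; proj₁; proj₂)
  open import Data.Sum using (_⊎_; inj₁; inj₂)
  open import Data.Empty using (⊥-elim)
  open import Relation.Nullary using (¬_; yes; no)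
  open import Relation.Binary.PropositionalEquality
  open import Data.List.Relation.Unary.All using ([]; lookup)
  open import Data.List.Relation.Unary.All.Properties using (¬Any⇒All¬)

  module Walks {m : ℕ} (R : Fin m → Fin m → Set) where

    open import Data.List.Membership.DecPropositional (_≟_ {m}) using (_∈?_)

    verts : ∀ {a b} → Walk R a b → List (Fin m)
    verts (here {x})     = x ∷ []
    verts (step {x} r w) = x ∷ verts w

    start∈ : ∀ {a b} (w : Walk R a b) → a ∈ verts w
    start∈ here       = here refl
    start∈ (step r w) = here refl

    _++w_ : ∀ {a b c} → Walk R a b → Walk R b c → Walk R a c
    here     ++w q = q
    step r p ++w q = step r (p ++w q)

    ++w-∈ : ∀ {a b c x} (p : Walk R a b) (q : Walk R b c) → x ∈ verts (p ++w q) → x ∈ verts p ⊎ x ∈ verts q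
    ++w-∈ here       q x∈ = inj₂ x∈
    ++w-∈ (step r p) q (here x≡) = inj₁ (here x≡)
    ++w-∈ (step r p) q (there x∈) with ++w-∈ p q x∈
    ... | inj₁ x∈p = inj₁ (there x∈p)
    ... | inj₂ x∈q = inj₂ x∈q

    module _ (Rsym : ∀ {x y} → R x y → R y x) where

      revOnto : ∀ {a b c} → Walk R a b → Walk R a c → Walk R b c
      revOnto here       acc = acc
      revOnto (step r p) acc = revOnto p (step (Rsym r) acc)

      revOnto-∈ : ∀ {a b c x} (p : Walk R a b) (acc : Walk R a c) →
                  x ∈ verts (revOnto p acc) → x ∈ verts p ⊎ x ∈ verts acc
      revOnto-∈ here       acc x∈ = inj₂ x∈
      revOnto-∈ (step r p) acc x∈ with revOnto-∈ p (step (Rsym r) acc) x∈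
      ... | inj₁ x∈p              = inj₁ (there x∈p)
      ... | inj₂ (here refl)      = inj₁ (there (start∈ p))
      ... | inj₂ (there x∈acc)    = inj₂ x∈acc

    dropUntil : ∀ {a b c} (w : Walk R b c) → a ∈ verts w → Walk R a c
    dropUntil here       (here refl) = here
    dropUntil (step r w) (here refl) = step r w
    dropUntil (step r w) (there a∈)  = dropUntil w a∈

    dropUntil-⊆ : ∀ {a b c x} (w : Walk R b c) (a∈ : a ∈ verts w) → x ∈ verts (dropUntil w a∈) → x ∈ verts w
    dropUntil-⊆ here       (here refl) x∈ = x∈
    dropUntil-⊆ (step r w) (here refl) x∈ = x∈
    dropUntil-⊆ (step r w) (there a∈)  x∈ = there (dropUntil-⊆ w a∈ x∈)

    dropUntil-unique : ∀ {a b c} (w : Walk R b c) (a∈ : a ∈ verts w) → Unique (verts w) → Unique (verts (dropUntil w a∈))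
    dropUntil-unique here       (here refl) u = u
    dropUntil-unique (step r w) (here refl) u = u
    dropUntil-unique (step r w) (there a∈)  (_ ∷ u) = dropUntil-unique w a∈ u

    toPath : ∀ {a b} (w : Walk R a b) → Σ (Walk R a b) λ p → Unique (verts p) × (∀ x → x ∈ verts p → x ∈ verts w)
    toPath (here {x}) = here , [] ∷ [] , λ _ x∈ → x∈
    toPath (step {a} r w) with toPath w
    ... | p , u , ⊆w with a ∈? verts p
    ...   | yes a∈ = dropUntil p a∈ , dropUntil-unique p a∈ u , λ x x∈ → there (⊆w x (dropUntil-⊆ p a∈ x∈))
    ...   | no  a∉ = step r p , ¬Any⇒All¬ (verts p) a∉ ∷ u , λ { x (here x≡) → here x≡ ; x (there x∈) → there (⊆w x x∈) }

    len : ∀ {a b} → Walk R a b → ℕ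
    len here       = 0
    len (step r w) = suc (len w)

    vertexAt : ∀ {a b} (w : Walk R a b) → Fin (suc (len w)) → Fin m
    vertexAt {a} w          zero    = a
    vertexAt     (step r w) (suc i) = vertexAt w i

    vertexAt-∈ : ∀ {a b} (w : Walk R a b) i → vertexAt w i ∈ verts w
    vertexAt-∈ here       zero    = here refl
    vertexAt-∈ (step r w) zero    = here refl
    vertexAt-∈ (step r w) (suc i) = there (vertexAt-∈ w i)

    vertexAt-injective : ∀ {a b} (w : Walk R a b) → Unique (verts w) → ∀ i j → vertexAt w i ≡ vertexAt w j → i ≡ j
    vertexAt-injective here       u       zero    zero    e = refl
    vertexAt-injective (step r w) u       zero    zero    e = refl
    vertexAt-injective (step r w) (a∉ ∷ u) zero   (suc j) e = ⊥-elim (lookup a∉ (vertexAt-∈ w j) e)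
    vertexAt-injective (step r w) (a∉ ∷ u) (suc i) zero   e = ⊥-elim (lookup a∉ (vertexAt-∈ w i) (sym e))
    vertexAt-injective (step r w) (a∉ ∷ u) (suc i) (suc j) e = cong suc (vertexAt-injective w u i j e)

    vertexAt-adjacent : ∀ {a b} (w : Walk R a b) (i : Fin (len w)) → R (vertexAt w (inject₁ i)) (vertexAt w (suc i))
    vertexAt-adjacent (step r w) zero    = r
    vertexAt-adjacent (step r w) (suc i) = vertexAt-adjacent w i

    vertexAt-last : ∀ {a b} (w : Walk R a b) → vertexAt w (fromℕ (len w)) ≡ b
    vertexAt-last here       = refl
    vertexAt-last (step r w) = vertexAt-last w

    closeCycle : ∀ {a b z} (w : Walk R b a) → Unique (verts w) → a ≢ b → z ∉ verts w → R z b → R a z → Cycle R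
    closeCycle here _ a≢b _ _ _ = ⊥-elim (a≢b refl)
    closeCycle {a} {b} {z} (step r w) u a≢b z∉ zRb aRz = record
      { k = len w ; vtx = vtx ; inj = vtx-inj ; adjSuc = vtx-adj
      ; closes = subst (λ q → R q z) (sym (vertexAt-last w)) aRz }
      where
        vtx : Fin (suc (suc (suc (len w)))) → Fin m
        vtx zero    = z
        vtx (suc i) = vertexAt (step r w) i
        vtx-inj : ∀ i j → vtx i ≡ vtx j → i ≡ j
        vtx-inj zero    zero    e = refl
        vtx-inj zero    (suc j) e = ⊥-elim (z∉ (subst (_∈ verts (step r w)) (sym e) (vertexAt-∈ (step r w) j)))
        vtx-inj (suc i) zero    e = ⊥-elim (z∉ (subst (_∈ verts (step r w)) e (vertexAt-∈ (step r w) i)))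
        vtx-inj (suc i) (suc j) e = cong suc (vertexAt-injective (step r w) u i j e)
        vtx-adj : ∀ (i : Fin (suc (suc (len w)))) → R (vtx (inject₁ i)) (vtx (suc i))
        vtx-adj zero    = zRb
        vtx-adj (suc i) = vertexAt-adjacent (step r w) i

    uniqueAttachment : (Rsym : ∀ {x y} → R x y → R y x) → ¬ Cycle R →
      ∀ {w b c z} (p : Walk R w c) (q : Walk R b c) → z ∉ verts p → z ∉ verts q → R w z → R z b → b ≡ w
    uniqueAttachment Rsym acyclic {w} {b} {c} {z} p q z∉p z∉q wRz zRb with b ≟ w
    ... | yes b≡w = b≡w
    ... | no  b≢w = ⊥-elim (acyclic (closeCycle path unique b≢w z∉path (Rsym wRz) (Rsym zRb)))
      where
        walk : Walk R w b
        walk = p ++w revOnto Rsym q here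
        path : Walk R w b
        path = proj₁ (toPath walk)
        unique : Unique (verts path)
        unique = proj₁ (proj₂ (toPath walk))
        z∉path : z ∉ verts path
        z∉path z∈ with ++w-∈ p _ (proj₂ (proj₂ (toPath walk)) _ z∈)
        ... | inj₁ z∈p = z∉p z∈p
        ... | inj₂ z∈r with revOnto-∈ Rsym q here z∈r
        ...   | inj₁ z∈q = z∉q z∈q
        ...   | inj₂ (here refl) = z∉q (start∈ q)


module DenseSubgraphs where

  open Counting
  open import Data.Nat using (ℕ; zero; suc; _+_; _*_; _≤_; _<_; _<?_)
  open import Data.Nat.Properties hiding (_≟_)
  open import Data.Nat.Tactic.RingSolver using (solve-∀)
  open import Data.Bool using (Bool; true; false)
  open import Data.Bool.Properties using (¬-not) renaming (_≟_ to _≟ᵇ_)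
  open import Data.Fin using (Fin)
  open import Data.Fin.Properties using (any?)
  open import Data.Product using (Σ; _×_; _,_)
  open import Data.Empty using (⊥-elim)
  open import Relation.Nullary using (¬_; yes; no)
  open import Relation.Nullary.Decidable using (_×-dec_)
  open import Relation.Binary.PropositionalEquality
  open import Algebra.Properties.CommutativeMonoid.Sum +-0-commutativeMonoid
    using (sum; sum-cong-≗; ∑-distrib-+)

  -- Every dense enough finite graph has a nonempty subgraph of minimum degree ≥ d:
  -- delete vertices of degree < d one at a time.
  module MinDegree {N : ℕ} (R : Fin N → Fin N → Bool) (Rsym : ∀ x y → R x y ≡ R y x) (d : ℕ) where

    deg : (Fin N → Bool) → Fin N → ℕ
    deg W x = sum (λ y → 𝟙 (W y) * 𝟙 (R x y))

    degSum : (Fin N → Bool) → ℕ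
    degSum W = sum (λ x → 𝟙 (W x) * deg W x)

    -- W is dense if its degree sum exceeds 2(d - 1)|W|, written without subtraction
    Dense : (Fin N → Bool) → Set
    Dense W = d * card W + d * card W < degSum W + (card W + card W)

    card-remove : ∀ (W : Fin N → Bool) x → W x ≡ true → card W ≡ suc (card (remove W x))
    card-remove W x Wx = begin
        card W                                       ≡⟨ sum-cong-≗ (λ y → sym (*-identityʳ (𝟙 (W y)))) ⟩
        sum (λ y → 𝟙 (W y) * 1)                     ≡⟨ sum-remove W x (λ _ → 1) Wx ⟩
        sum (λ y → 𝟙 (remove W x y) * 1) + 1        ≡⟨ cong (_+ 1) (sum-cong-≗ (λ y → *-identityʳ (𝟙 (remove W x y)))) ⟩
        card (remove W x) + 1                        ≡⟨ +-comm _ 1 ⟩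
        suc (card (remove W x))                      ∎
      where open ≡-Reasoning

    degSum-remove : ∀ (W : Fin N → Bool) x → W x ≡ true → degSum W ≤ degSum (remove W x) + (deg W x + deg W x)
    degSum-remove W x Wx = begin
        degSum W
      ≡⟨ sum-remove W x (deg W) Wx ⟩
        sum (λ y → 𝟙 (W' y) * deg W y) + deg W x
      ≡⟨ cong (_+ deg W x) (sum-cong-≗ (λ y → cong (𝟙 (W' y) *_) (sum-remove W x (λ y' → 𝟙 (R y y')) Wx))) ⟩
        sum (λ y → 𝟙 (W' y) * (deg W' y + 𝟙 (R y x))) + deg W x
      ≡⟨ cong (_+ deg W x) (trans (sum-cong-≗ (λ y → *-distribˡ-+ (𝟙 (W' y)) (deg W' y) (𝟙 (R y x))))
                                   (∑-distrib-+ (λ y → 𝟙 (W' y) * deg W' y) (λ y → 𝟙 (W' y) * 𝟙 (R y x)))) ⟩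
        degSum W' + sum (λ y → 𝟙 (W' y) * 𝟙 (R y x)) + deg W x
      ≤⟨ +-monoˡ-≤ (deg W x) (+-monoʳ-≤ (degSum W') (sum-mono (λ y →
           *-mono-≤ (remove≤ W x y) (≤-reflexive (cong 𝟙 (Rsym y x)))))) ⟩
        degSum W' + deg W x + deg W x
      ≡⟨ +-assoc (degSum W') _ _ ⟩
        degSum W' + (deg W x + deg W x)
      ∎
      where
        open ≤-Reasoning
        W' : Fin N → Bool
        W' = remove W x

    -- the counting behind one deletion step, with c = |W'|, Δ = deg x, D = degree sums
    deletion-arithmetic : ∀ c Δ D D' → suc Δ ≤ d → D ≤ D' + (Δ + Δ) →
      d * suc c + d * suc c < D + (suc c + suc c) → d * c + d * c < D' + (c + c)
    deletion-arithmetic c Δ D D' Δ<d D≤ dense = +-cancelˡ-< (d + d) _ _ (begin-strict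
        d + d + (d * c + d * c)             ≡⟨ expand d c ⟩
        d * suc c + d * suc c               <⟨ dense ⟩
        D + (suc c + suc c)                 ≤⟨ +-monoˡ-≤ _ D≤ ⟩
        D' + (Δ + Δ) + (suc c + suc c)      ≡⟨ regroup D' Δ c ⟩
        suc Δ + suc Δ + (D' + (c + c))      ≤⟨ +-monoˡ-≤ _ (+-mono-≤ Δ<d Δ<d) ⟩
        d + d + (D' + (c + c))              ∎)
      where
        open ≤-Reasoning
        expand : ∀ d c → d + d + (d * c + d * c) ≡ d * suc c + d * suc c
        expand = solve-∀
        regroup : ∀ D' Δ c → D' + (Δ + Δ) + (suc c + suc c) ≡ suc Δ + suc Δ + (D' + (c + c))
        regroup = solve-∀

    dense-remove : ∀ (W : Fin N → Bool) x → Dense W → W x ≡ true → deg W x < d → Dense (remove W x)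
    dense-remove W x dense Wx low =
      deletion-arithmetic (card (remove W x)) (deg W x) (degSum W) (degSum (remove W x)) low
        (degSum-remove W x Wx) (subst (λ c → d * c + d * c < degSum W + (c + c)) (card-remove W x Wx) dense)

    empty-sparse : ∀ (W : Fin N → Bool) → (∀ x → W x ≡ false) → ¬ Dense W
    empty-sparse W empty dense = n≮0 (subst₂ _<_ (cong (λ c → d * c + d * c) card0) (cong₂ _+_ degSum0 (cong (λ c → c + c) card0)) dense)
      where
        card0 : card W ≡ 0
        card0 = sum-zero (λ y → cong 𝟙 (empty y))
        degSum0 : degSum W ≡ 0
        degSum0 = sum-zero (λ y → cong (λ b → 𝟙 b * deg W y) (empty y))

    MinDegreeSubgraph : Set
    MinDegreeSubgraph = Σ (Fin N → Bool) λ W → (Σ (Fin N) λ x → W x ≡ true) × (∀ x → W x ≡ true → d ≤ deg W x)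

    -- by induction on |W|: delete a vertex of degree < d while there is one; density
    -- keeps W nonempty, and when no such vertex is left W is the subgraph sought
    minDegreeSubgraph : ∀ (W : Fin N → Bool) → Dense W → MinDegreeSubgraph
    minDegreeSubgraph W = go (card W) W refl
      where
        go : ∀ k (W : Fin N → Bool) → card W ≡ k → Dense W → MinDegreeSubgraph
        go k W ∣W∣≡k dense with any? (λ x → (W x ≟ᵇ true) ×-dec (deg W x <? d))
        go zero    W ∣W∣≡k dense | yes (x , Wx , _)   = ⊥-elim (1+n≢0 (trans (sym (card-remove W x Wx)) ∣W∣≡k))
        go (suc k) W ∣W∣≡k dense | yes (x , Wx , low) =
          go k (remove W x) (suc-injective (trans (sym (card-remove W x Wx)) ∣W∣≡k)) (dense-remove W x dense Wx low)
        ... | no noLow with any? (λ x → W x ≟ᵇ true)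
        ...   | yes (x , Wx) = W , (x , Wx) , λ y Wy → ≮⇒≥ (λ low → noLow (y , Wy , low))
        ...   | no  noneIn   = ⊥-elim (empty-sparse W (λ y → ¬-not (λ Wy → noneIn (y , Wy))) dense)


module AverageDegree where

  open import Defs using (Graph; EdgeSetIn; avgDeg; vertsE; degE; sumF; twoPowNeg; invPos; ℕtoℚ)
  open import Data.Nat as ℕ using (ℕ; zero; suc; _+_; _^_; NonZero) renaming (_*_ to _*ℕ_; _≤_ to _≤ℕ_; _<_ to _<ℕ_)
  import Data.Nat.Properties as ℕP
  open import Data.Integer as ℤ using (+_)
  import Data.Integer.Properties as ℤP
  open import Data.Rational as ℚ using (ℚ; 0ℚ; 1ℚ; _/_; _*_; _≤_; _>_; toℚᵘ)
  import Data.Rational.Properties as ℚP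
  import Data.Rational.Unnormalised as ℚᵘ
  import Data.Rational.Unnormalised.Properties as ℚᵘP
  open import Data.Rational.Solver using (module +-*-Solver)
  open import Data.Product using (_×_; _,_)
  open import Data.Empty using (⊥-elim)
  open import Relation.Nullary using (¬_)
  open import Relation.Binary.PropositionalEquality

  average : ℕ → ℕ → ℚ
  average zero    S = 0ℚ
  average (suc V) S = (+ S) / suc V

  avgDeg≡average : ∀ {n} {G : Graph n} {X} (D : EdgeSetIn G X) → avgDeg D ≡ average (vertsE D) (sumF (degE D))
  avgDeg≡average D with vertsE D
  ... | zero  = refl
  ... | suc _ = refl

  toℚᵘ-ℕtoℚ : ∀ k → toℚᵘ (ℕtoℚ k) ℚᵘ.≃ ℚᵘ.mkℚᵘ (+ k) 0
  toℚᵘ-ℕtoℚ k = ℚP.toℚᵘ-fromℚᵘ (ℚᵘ.mkℚᵘ (+ k) 0)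

  ℕtoℚ-* : ∀ a b → ℕtoℚ (a *ℕ b) ≡ ℕtoℚ a * ℕtoℚ b
  ℕtoℚ-* a b = ℚP.toℚᵘ-injective (begin
      toℚᵘ (ℕtoℚ (a *ℕ b))                    ≈⟨ toℚᵘ-ℕtoℚ (a *ℕ b) ⟩
      ℚᵘ.mkℚᵘ (+ (a *ℕ b)) 0                  ≈⟨ ℚᵘ.*≡* (cong (ℤ._* + 1) (ℤP.pos-* a b)) ⟩
      ℚᵘ.mkℚᵘ (+ a) 0 ℚᵘ.* ℚᵘ.mkℚᵘ (+ b) 0    ≈⟨ ℚᵘP.*-cong (toℚᵘ-ℕtoℚ a) (toℚᵘ-ℕtoℚ b) ⟨
      toℚᵘ (ℕtoℚ a) ℚᵘ.* toℚᵘ (ℕtoℚ b)        ≈⟨ ℚP.toℚᵘ-homo-* (ℕtoℚ a) (ℕtoℚ b) ⟨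
      toℚᵘ (ℕtoℚ a * ℕtoℚ b)                  ∎)
    where open ℚᵘP.≃-Reasoning

  twoPowNeg-inverse : ∀ ℓ → twoPowNeg ℓ * ℕtoℚ (2 ^ ℓ) ≡ 1ℚ
  twoPowNeg-inverse ℓ = inverse (2 ^ ℓ) {{ℕP.m^n≢0 2 ℓ}}
    where
      inverse : ∀ d .{{_ : NonZero d}} → ((+ 1) / d) * ((+ d) / 1) ≡ 1ℚ
      inverse (suc d) = ℚP.toℚᵘ-injective (begin
          toℚᵘ (((+ 1) / suc d) * ((+ suc d) / 1))               ≈⟨ ℚP.toℚᵘ-homo-* ((+ 1) / suc d) ((+ suc d) / 1) ⟩
          toℚᵘ ((+ 1) / suc d) ℚᵘ.* toℚᵘ ((+ suc d) / 1)     ≈⟨ ℚᵘP.*-cong (ℚP.toℚᵘ-fromℚᵘ (ℚᵘ.mkℚᵘ (+ 1) d)) (toℚᵘ-ℕtoℚ (suc d)) ⟩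
          ℚᵘ.mkℚᵘ (+ 1) d ℚᵘ.* ℚᵘ.mkℚᵘ (+ suc d) 0          ≈⟨ ℚᵘ.*≡* cross ⟩
          toℚᵘ 1ℚ                                              ∎)
        where
          open ℚᵘP.≃-Reasoning
          cross : (+ 1 ℤ.* + suc d) ℤ.* + 1 ≡ + 1 ℤ.* (+ suc (d *ℕ 1))
          cross = trans (ℤP.*-identityʳ _) (cong (λ k → + 1 ℤ.* + suc k) (sym (ℕP.*-identityʳ d)))

  scaledThreshold : ∀ ℓ α (αpos : α > 0ℚ) s →
    twoPowNeg ℓ * α * (ℕtoℚ (2 ^ (ℓ + 3)) * invPos α αpos * ℕtoℚ s) ≡ ℕtoℚ (8 *ℕ s)
  scaledThreshold ℓ α αpos s = begin
      twoPowNeg ℓ * α * (ℕtoℚ (2 ^ (ℓ + 3)) * α⁻¹ * ℕtoℚ s)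
    ≡⟨ cong (λ q → twoPowNeg ℓ * α * (q * α⁻¹ * ℕtoℚ s)) (trans (cong ℕtoℚ (ℕP.^-distribˡ-+-* 2 ℓ 3)) (ℕtoℚ-* (2 ^ ℓ) 8)) ⟩
      twoPowNeg ℓ * α * (ℕtoℚ (2 ^ ℓ) * ℕtoℚ 8 * α⁻¹ * ℕtoℚ s)
    ≡⟨ regroup (twoPowNeg ℓ) α (ℕtoℚ (2 ^ ℓ)) (ℕtoℚ 8) α⁻¹ (ℕtoℚ s) ⟩
      (twoPowNeg ℓ * ℕtoℚ (2 ^ ℓ)) * (α * α⁻¹) * (ℕtoℚ 8 * ℕtoℚ s)
    ≡⟨ cong₂ (λ u v → u * v * (ℕtoℚ 8 * ℕtoℚ s)) (twoPowNeg-inverse ℓ) (ℚP.*-inverseʳ α {{ℚ.>-nonZero αpos}}) ⟩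
      1ℚ * 1ℚ * (ℕtoℚ 8 * ℕtoℚ s)
    ≡⟨ trans (cong (_* (ℕtoℚ 8 * ℕtoℚ s)) (ℚP.*-identityˡ 1ℚ)) (ℚP.*-identityˡ _) ⟩
      ℕtoℚ 8 * ℕtoℚ s
    ≡⟨ ℕtoℚ-* 8 s ⟨
      ℕtoℚ (8 *ℕ s)
    ∎
    where
      open ≡-Reasoning
      α⁻¹ = invPos α αpos
      open +-*-Solver
      regroup : ∀ a b c d e f → a * b * (c * d * e * f) ≡ (a * c) * (b * e) * (d * f)
      regroup = solve 6 (λ a b c d e f → a :* b :* (c :* d :* e :* f) := (a :* c) :* (b :* e) :* (d :* f)) refl

  ℕtoℚ≤fraction : ∀ a S V → ℕtoℚ a ≤ (+ S) / suc V → a *ℕ suc V ≤ℕ S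
  ℕtoℚ≤fraction a S V h with ℚᵘP.≤-respʳ-≃ (ℚP.toℚᵘ-fromℚᵘ (ℚᵘ.mkℚᵘ (+ S) V))
                               (ℚᵘP.≤-respˡ-≃ (toℚᵘ-ℕtoℚ a) (ℚP.toℚᵘ-mono-≤ h))
  ... | ℚᵘ.*≤* p = subst (a *ℕ suc V ≤ℕ_) (ℕP.*-identityʳ S)
        (ℤP.drop‿+≤+ (subst₂ ℤ._≤_ (sym (ℤP.pos-* a (suc V))) (sym (ℤP.pos-* S 1)) p))

  positive≰0 : ∀ a → 1 ≤ℕ a → ¬ ℕtoℚ a ≤ 0ℚ
  positive≰0 a 1≤a h with ℚᵘP.≤-respˡ-≃ (toℚᵘ-ℕtoℚ a) (ℚP.toℚᵘ-mono-≤ h)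
  ... | ℚᵘ.*≤* p = ℕP.<-irrefl refl (ℕP.≤-trans 1≤a
        (subst (ℕ._≤ 0) (ℕP.*-identityʳ a) (ℤP.drop‿+≤+ (subst (ℤ._≤ + 0) (sym (ℤP.pos-* a 1)) p))))

  ℕ≤average : ∀ a V S → 1 ≤ℕ a → ℕtoℚ a ≤ average V S → 0 <ℕ V × a *ℕ V ≤ℕ S
  ℕ≤average a zero    S 1≤a a≤0 = ⊥-elim (positive≰0 a 1≤a a≤0)
  ℕ≤average a (suc V) S _   a≤S/V = ℕ.s≤s ℕ.z≤n , ℕtoℚ≤fraction a S V a≤S/V

  averageDegreeBound : ∀ ℓ α (αpos : α > 0ℚ) C s → 1 ≤ℕ s →
    ℕtoℚ (2 ^ (ℓ + 3)) * invPos α αpos * ℕtoℚ s ≤ C →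
    ∀ {n} {G : Graph n} {X} (D : EdgeSetIn G X) → twoPowNeg ℓ * α * C ≤ avgDeg D →
    0 <ℕ vertsE D × 8 *ℕ s *ℕ vertsE D ≤ℕ sumF (degE D)
  averageDegreeBound ℓ α αpos C s 1≤s C-large D dense =
    ℕ≤average (8 *ℕ s) (vertsE D) (sumF (degE D)) (ℕP.≤-trans 1≤s (ℕP.m≤n*m s 8)) (begin
      ℕtoℚ (8 *ℕ s)                                                         ≡⟨ scaledThreshold ℓ α αpos s ⟨
      twoPowNeg ℓ * α * (ℕtoℚ (2 ^ (ℓ + 3)) * invPos α αpos * ℕtoℚ s)      ≤⟨ ℚP.*-monoˡ-≤-nonNeg (twoPowNeg ℓ * α) C-large ⟩
      twoPowNeg ℓ * α * C                                                   ≤⟨ dense ⟩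
      avgDeg D                                                              ≡⟨ avgDeg≡average D ⟩
      average (vertsE D) (sumF (degE D))                                    ∎)
    where
      open ℚP.≤-Reasoning
      instance
        2^-ℓ-nonNeg : ℚ.NonNegative (twoPowNeg ℓ)
        2^-ℓ-nonNeg = ℚP.normalize-nonNeg 1 (2 ^ ℓ) {{ℕP.m^n≢0 2 ℓ}}
        α-nonNeg : ℚ.NonNegative α
        α-nonNeg = ℚ.nonNegative (ℚP.<⇒≤ αpos)
        scale-nonNeg : ℚ.NonNegative (twoPowNeg ℓ * α)
        scale-nonNeg = ℚP.nonNeg*nonNeg⇒nonNeg (twoPowNeg ℓ) α


module BipartiteHosts where

  open import Defs hiding (sym)
  open Counting
  open TreePaths
  open import Data.Nat using (ℕ; zero; suc; _+_; _≤_; _<_)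
  open import Data.Nat.Properties hiding (_≟_)
  open import Data.Bool using (Bool; true; false; _∧_; not)
  open import Data.Bool.Properties using (not-involutive; ¬-not; not-¬) renaming (_≟_ to _≟ᵇ_)
  open import Data.Fin using (Fin; zero; suc; fromℕ<; _≟_)
  open import Data.List using (List; []; _∷_; allFin)
  open import Data.List.Relation.Unary.Any using (here; there)
  open import Data.List.Membership.Propositional using (_∈_)
  open import Data.List.Membership.Propositional.Properties using (∈-allFin)
  open import Data.Product using (Σ; _×_; _,_; proj₁; proj₂)
  open import Data.Sum using (_⊎_; inj₁; inj₂)
  open import Data.Empty using (⊥-elim)
  open import Relation.Nullary using (¬_; yes; no)
  open import Relation.Binary.PropositionalEquality
  open import Function using (_∘_)
  open import Algebra.Properties.CommutativeMonoid.Sum +-0-commutativeMonoid using (sum)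

  -- A bipartite host graph with sides indexed by Bool. A vertex v on side b is
  -- alive when `alive b v`; `link b v u` joins v on side b to u on side not b.
  record Host (n s : ℕ) : Set where
    field
      alive     : Bool → Fin n → Bool
      link      : Bool → Fin n → Fin n → Bool
      link-sym  : ∀ b v u → link b v u ≡ link (not b) u v
      minDegree : ∀ b v → alive b v ≡ true → s ≤ card (λ u → alive (not b) u ∧ link b v u)
      someAlive : Σ Bool λ b → Σ (Fin n) λ v → alive b v ≡ true

  module HostProperties {n s : ℕ} (H : Host n s) where
    open Host H

    neighbour : 1 ≤ s → ∀ b v → alive b v ≡ true → Σ (Fin n) λ u → alive (not b) u ≡ true × link b v u ≡ true
    neighbour 1≤s b v alive-v with witness _ (≤-trans 1≤s (minDegree b v alive-v))
    ... | u , u-nb = u , ∧-true u-nb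

    opposite-large : ∀ b v → alive b v ≡ true → s ≤ card (alive (not b))
    opposite-large b v alive-v = ≤-trans (minDegree b v alive-v) (sum-mono (λ u → 𝟙-∧≤ (alive (not b) u) _))

    side-large : 1 ≤ s → ∀ c → s ≤ card (alive c)
    side-large 1≤s c with someAlive
    ... | b , v , alive-v with c ≟ᵇ b
    ...   | no  c≢b = subst (λ c → s ≤ card (alive c)) (sym (¬-not c≢b)) (opposite-large b v alive-v)
    ...   | yes refl with neighbour 1≤s c v alive-v
    ...     | u , alive-u , _ = subst (λ c → s ≤ card (alive c)) (not-involutive c) (opposite-large (not c) u alive-u)

  -- A vertex a of T is placed on side inA a, so the
  -- two classes of the bipartition of T go to the two sides of the host.
  module TreeEmbedding {n s : ℕ} (H : Host n s) (T : Tree) (U : Fin n → Bool)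
                       (budget : card U + size T ≤ s) where
    open Host H
    open HostProperties H
    open Walks (Adj T)

    m : ℕ
    m = size T

    root : Fin m
    root = fromℕ< (nonempty T)

    -- A partial embedding, defined on the subtree `placed` containing the root;
    -- `used` consists of U and the image.
    record Partial : Set where
      field
        placed      : Fin m → Bool
        φ           : Fin m → Fin n
        used        : Fin n → Bool
        root-placed : placed root ≡ true
        toRoot      : ∀ a → placed a ≡ true → Σ (Walk (Adj T) a root) λ p → ∀ x → x ∈ verts p → placed x ≡ true
        card-used   : card used ≡ card U + card placed
        U⊆used      : ∀ g → U g ≡ true → used g ≡ true
        avoids      : ∀ a → placed a ≡ true → U (φ a) ≡ false
        image⊆used  : ∀ a → placed a ≡ true → used (φ a) ≡ true
        injective   : ∀ a b → placed a ≡ true → placed b ≡ true → φ a ≡ φ b → a ≡ b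
        on-side     : ∀ a → placed a ≡ true → alive (inA T a) (φ a) ≡ true
        edges       : ∀ a b → placed a ≡ true → placed b ≡ true → Adj T a b → link (inA T a) (φ a) (φ b) ≡ true
    open Partial

    Grows : Partial → Partial → Set
    Grows π π' = ∀ a → placed π a ≡ true → placed π' a ≡ true

    -- since T is acyclic, an unplaced vertex has at most one placed neighbour
    single-placed-neighbour : (π : Partial) → ∀ {w z b} → placed π w ≡ true → placed π z ≡ false → placed π b ≡ true →
                              Adj T w z → Adj T z b → b ≡ w
    single-placed-neighbour π {w} {z} {b} placed-w unplaced-z placed-b =
      uniqueAttachment (Tree.sym T) (acyclic T) (proj₁ (toRoot π w placed-w)) (proj₁ (toRoot π b placed-b))
        (off-walk placed-w) (off-walk placed-b)
      where
        off-walk : ∀ {a} (placed-a : placed π a ≡ true) → ¬ z ∈ verts (proj₁ (toRoot π a placed-a))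
        off-walk {a} placed-a z∈ = not-¬ (proj₂ (toRoot π a placed-a) z z∈) unplaced-z

    -- Placing an unplaced vertex z next to a placed neighbour w: z goes to an
    -- unused alive neighbour of the image of w, which exists as |U| + |T| ≤ s.
    module Extend (π : Partial) {w z} (placed-w : placed π w ≡ true) (unplaced-z : placed π z ≡ false)
                  (wz : Adj T w z) where

      -- w lies on side inA w, so z must go to the other side, among the neighbours of the image of w
      side : Bool
      side = inA T w

      candidates : Fin n → Bool
      candidates g = alive (not side) g ∧ link side (φ π w) g

      used<candidates : card (used π) < card candidates
      used<candidates = begin-strict
          card (used π)              ≡⟨ card-used π ⟩
          card U + card (placed π)   <⟨ +-monoʳ-< (card U) (card< (placed π) z unplaced-z) ⟩
          card U + m                 ≤⟨ budget ⟩
          s                          ≤⟨ minDegree side (φ π w) (on-side π w placed-w) ⟩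
          card candidates            ∎
        where open ≤-Reasoning

      g : Fin n
      g = proj₁ (pigeonhole candidates (used π) used<candidates)

      g-candidate : alive (not side) g ≡ true × link side (φ π w) g ≡ true
      g-candidate = ∧-true (proj₁ (proj₂ (pigeonhole candidates (used π) used<candidates)))

      g-unused : used π g ≡ false
      g-unused = proj₂ (proj₂ (pigeonhole candidates (used π) used<candidates))

      g-avoids : U g ≡ false
      g-avoids = ¬-not (λ Ug → not-¬ (U⊆used π g Ug) g-unused)

      g-fresh : ∀ {a} → placed π a ≡ true → φ π a ≢ g
      g-fresh {a} placed-a φa≡g = not-¬ (image⊆used π a placed-a) (trans (cong (used π) φa≡g) g-unused)

      z-side : inA T z ≡ not side
      z-side = ¬-not (λ e → bip T wz (sym e))

      φ' : Fin m → Fin n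
      φ' a with a ≟ z
      ... | yes _ = g
      ... | no  _ = φ π a

      φ'-new : φ' z ≡ g
      φ'-new with z ≟ z
      ... | yes _   = refl
      ... | no  z≢z = ⊥-elim (z≢z refl)

      φ'-old : ∀ {a} → placed π a ≡ true → φ' a ≡ φ π a
      φ'-old {a} placed-a with a ≟ z
      ... | yes refl = ⊥-elim (not-¬ placed-a unplaced-z)
      ... | no  _    = refl

      placed' : Fin m → Bool
      placed' = insert (placed π) z

      placed'-cases : ∀ a → placed' a ≡ true → placed π a ≡ true ⊎ a ≡ z
      placed'-cases = insert-cases (placed π) z

      -- the walk from z to the root goes through w
      toRoot' : ∀ a → placed' a ≡ true → Σ (Walk (Adj T) a root) λ p → ∀ x → x ∈ verts p → placed' x ≡ true
      toRoot' a placed'-a with placed'-cases a placed'-a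
      ... | inj₁ placed-a = proj₁ (toRoot π a placed-a) , λ x x∈ → insert-old (placed π) z (proj₂ (toRoot π a placed-a) x x∈)
      ... | inj₂ refl     = step (Tree.sym T wz) (proj₁ (toRoot π w placed-w)) , on-walk
        where
          on-walk : ∀ x → x ∈ verts (step (Tree.sym T wz) (proj₁ (toRoot π w placed-w))) → placed' x ≡ true
          on-walk x (here refl) = insert-new (placed π) z
          on-walk x (there x∈)  = insert-old (placed π) z (proj₂ (toRoot π w placed-w) x x∈)

      card-used' : card (insert (used π) g) ≡ card U + card placed'
      card-used' = begin
          card (insert (used π) g)          ≡⟨ card-insert (used π) g g-unused ⟩
          suc (card (used π))               ≡⟨ cong suc (card-used π) ⟩
          suc (card U + card (placed π))    ≡⟨ +-suc (card U) _ ⟨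
          card U + suc (card (placed π))    ≡⟨ cong (card U +_) (card-insert (placed π) z unplaced-z) ⟨
          card U + card placed'             ∎
        where open ≡-Reasoning

      avoids' : ∀ a → placed' a ≡ true → U (φ' a) ≡ false
      avoids' a placed'-a with placed'-cases a placed'-a
      ... | inj₁ placed-a = trans (cong U (φ'-old placed-a)) (avoids π a placed-a)
      ... | inj₂ refl     = trans (cong U φ'-new) g-avoids

      image⊆used' : ∀ a → placed' a ≡ true → insert (used π) g (φ' a) ≡ true
      image⊆used' a placed'-a with placed'-cases a placed'-a
      ... | inj₁ placed-a rewrite φ'-old placed-a = insert-old (used π) g (image⊆used π a placed-a)
      ... | inj₂ refl     rewrite φ'-new          = insert-new (used π) g

      injective' : ∀ a b → placed' a ≡ true → placed' b ≡ true → φ' a ≡ φ' b → a ≡ b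
      injective' a b placed'-a placed'-b φ'a≡φ'b with placed'-cases a placed'-a | placed'-cases b placed'-b
      ... | inj₁ placed-a | inj₁ placed-b =
        injective π a b placed-a placed-b (trans (sym (φ'-old placed-a)) (trans φ'a≡φ'b (φ'-old placed-b)))
      ... | inj₁ placed-a | inj₂ refl = ⊥-elim (g-fresh placed-a (trans (sym (φ'-old placed-a)) (trans φ'a≡φ'b φ'-new)))
      ... | inj₂ refl | inj₁ placed-b = ⊥-elim (g-fresh placed-b (trans (sym (φ'-old placed-b)) (trans (sym φ'a≡φ'b) φ'-new)))
      ... | inj₂ refl | inj₂ refl = refl

      on-side' : ∀ a → placed' a ≡ true → alive (inA T a) (φ' a) ≡ true
      on-side' a placed'-a with placed'-cases a placed'-a
      ... | inj₁ placed-a rewrite φ'-old placed-a = on-side π a placed-a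
      ... | inj₂ refl     rewrite φ'-new | z-side = proj₁ g-candidate

      -- the only new tree edge is wz, and it is mapped to a link by the choice of g
      edges' : ∀ a b → placed' a ≡ true → placed' b ≡ true → Adj T a b → link (inA T a) (φ' a) (φ' b) ≡ true
      edges' a b placed'-a placed'-b ab with placed'-cases a placed'-a | placed'-cases b placed'-b
      ... | inj₁ placed-a | inj₁ placed-b rewrite φ'-old placed-a | φ'-old placed-b = edges π a b placed-a placed-b ab
      ... | inj₁ placed-a | inj₂ refl with single-placed-neighbour π placed-w unplaced-z placed-a wz (Tree.sym T ab)
      ...   | refl rewrite φ'-old placed-w | φ'-new = proj₂ g-candidate
      edges' a b placed'-a placed'-b ab | inj₂ refl | inj₁ placed-b with single-placed-neighbour π placed-w unplaced-z placed-b wz ab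
      ...   | refl rewrite φ'-old placed-w | φ'-new | z-side
        = trans (link-sym (not side) g (φ π w)) (subst (λ c → link c (φ π w) g ≡ true) (sym (not-involutive side)) (proj₂ g-candidate))
      edges' a b placed'-a placed'-b ab | inj₂ refl | inj₂ refl = ⊥-elim (irrefl T ab)

      extended : Partial
      extended = record
        { placed = placed' ; φ = φ' ; used = insert (used π) g
        ; root-placed = insert-old (placed π) z (root-placed π)
        ; toRoot = toRoot' ; card-used = card-used'
        ; U⊆used = λ h Uh → insert-old (used π) g (U⊆used π h Uh)
        ; avoids = avoids' ; image⊆used = image⊆used' ; injective = injective'
        ; on-side = on-side' ; edges = edges' }

      grows : Grows π extended
      grows a = insert-old (placed π) z

      z-placed : placed extended z ≡ true
      z-placed = insert-new (placed π) z

    placeAlong : (π : Partial) → ∀ {a y} → placed π a ≡ true → Walk (Adj T) a y →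
                 Σ Partial λ π' → Grows π π' × placed π' y ≡ true
    placeAlong π placed-a here = π , (λ _ p → p) , placed-a
    placeAlong π placed-a (step {y = b} ab walk) with placed π b in placed-b
    ... | true  = placeAlong π placed-b walk
    ... | false with placeAlong (Extend.extended π placed-a placed-b ab) (Extend.z-placed π placed-a placed-b ab) walk
    ...   | π' , grows' , placed-y = π' , (λ x p → grows' x (Extend.grows π placed-a placed-b ab x p)) , placed-y

    placeAll : (π : Partial) (ys : List (Fin m)) → Σ Partial λ π' → Grows π π' × (∀ y → y ∈ ys → placed π' y ≡ true)
    placeAll π []       = π , (λ _ p → p) , λ _ ()
    placeAll π (y ∷ ys) with placeAlong π (root-placed π) (connected T root y)
    ... | π₁ , grows₁ , placed-y with placeAll π₁ ys
    ...   | π₂ , grows₂ , placed-ys = π₂ , (λ x p → grows₂ x (grows₁ x p)) , λ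
      { y' (here refl)  → grows₂ y' placed-y
      ; y' (there y'∈)  → placed-ys y' y'∈ }

    1≤s : 1 ≤ s
    1≤s = ≤-trans (nonempty T) (≤-trans (m≤n+m m (card U)) budget)

    rootImage : Σ (Fin n) λ v → alive (inA T root) v ≡ true × U v ≡ false
    rootImage = pigeonhole (alive (inA T root)) U (begin-strict
        card U      <⟨ m<m+n (card U) (nonempty T) ⟩
        card U + m  ≤⟨ budget ⟩
        s           ≤⟨ side-large 1≤s (inA T root) ⟩
        card (alive (inA T root)) ∎)
      where open ≤-Reasoning

    initial : Partial
    initial = record
      { placed = onlyRoot ; φ = λ _ → v₀ ; used = insert U v₀
      ; root-placed = insert-new _ root
      ; toRoot = λ a p → toRoot₀ a (is-root a p)
      ; card-used = card-used₀
      ; U⊆used = λ g Ug → insert-old U v₀ Ug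
      ; avoids = λ _ _ → proj₂ (proj₂ rootImage)
      ; image⊆used = λ _ _ → insert-new U v₀
      ; injective = λ a b pa pb _ → trans (is-root a pa) (sym (is-root b pb))
      ; on-side = λ a pa → subst (λ r → alive (inA T r) v₀ ≡ true) (sym (is-root a pa)) (proj₁ (proj₂ rootImage))
      ; edges = λ a b pa pb ab → ⊥-elim (irrefl T (subst (Adj T a) (trans (is-root b pb) (sym (is-root a pa))) ab))
      }
      where
        v₀ = proj₁ rootImage
        onlyRoot : Fin m → Bool
        onlyRoot = insert (λ _ → false) root
        is-root : ∀ a → onlyRoot a ≡ true → a ≡ root
        is-root a p with insert-cases (λ _ → false) root a p
        ... | inj₂ a≡root = a≡root
        toRoot₀ : ∀ a → a ≡ root → Σ (Walk (Adj T) a root) λ p → ∀ x → x ∈ verts p → onlyRoot x ≡ true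
        toRoot₀ a refl = here , λ { x (here refl) → insert-new _ root }
        card-used₀ : card (insert U v₀) ≡ card U + card onlyRoot
        card-used₀ = begin
            card (insert U v₀)             ≡⟨ card-insert U v₀ (proj₂ (proj₂ rootImage)) ⟩
            suc (card U)                   ≡⟨ +-comm 1 (card U) ⟩
            card U + 1                     ≡⟨ cong (λ c → card U + suc c) (sum-zero {m} (λ _ → refl)) ⟨
            card U + suc (card {m} (λ _ → false)) ≡⟨ cong (card U +_) (card-insert (λ _ → false) root refl) ⟨
            card U + card onlyRoot         ∎
          where open ≡-Reasoning

    record Embedding : Set where
      field
        φ          : Fin m → Fin n
        used       : Fin n → Bool
        card-used  : card used ≡ card U + m
        U⊆used     : ∀ g → U g ≡ true → used g ≡ true
        avoids     : ∀ a → U (φ a) ≡ false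
        image⊆used : ∀ a → used (φ a) ≡ true
        injective  : ∀ a b → φ a ≡ φ b → a ≡ b
        on-side    : ∀ a → alive (inA T a) (φ a) ≡ true
        edges      : ∀ a b → Adj T a b → link (inA T a) (φ a) (φ b) ≡ true

    embed : Embedding
    embed with placeAll initial (allFin m)
    ... | π , _ , placed-all = record
      { φ = φ π ; used = used π
      ; card-used = trans (card-used π) (cong (card U +_) (card-full (placed π) all))
      ; U⊆used = U⊆used π
      ; avoids = λ a → avoids π a (all a)
      ; image⊆used = λ a → image⊆used π a (all a)
      ; injective = λ a b → injective π a b (all a) (all b)
      ; on-side = λ a → on-side π a (all a)
      ; edges = λ a b → edges π a b (all a) (all b) }
      where
        all : ∀ a → placed π a ≡ true
        all a = placed-all a (∈-allFin a)

  record DisjointEmbeddings {n s ℓ : ℕ} (H : Fin ℓ → Host n s) (T : Fin ℓ → Tree) (U : Fin n → Bool) : Set where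
    field
      φ         : (j : Fin ℓ) → Fin (size (T j)) → Fin n
      injective : ∀ j a b → φ j a ≡ φ j b → a ≡ b
      disjoint  : ∀ j j' a b → j ≢ j' → φ j a ≢ φ j' b
      on-side   : ∀ j a → Host.alive (H j) (inA (T j) a) (φ j a) ≡ true
      edges     : ∀ j a b → Adj (T j) a b → Host.link (H j) (inA (T j) a) (φ j a) (φ j b) ≡ true
      avoids    : ∀ j a → U (φ j a) ≡ false

  -- Embed the trees one after another, each avoiding the images of the earlier ones;
  -- the budget |U| + Σ|Tⱼ| ≤ s is what each greedy embedding needs.
  embedDisjointly : ∀ {n s} ℓ (H : Fin ℓ → Host n s) (T : Fin ℓ → Tree) (U : Fin n → Bool) →
                    card U + sum (λ j → size (T j)) ≤ s → DisjointEmbeddings H T U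
  embedDisjointly zero H T U budget = record
    { φ = λ () ; injective = λ () ; disjoint = λ () ; on-side = λ () ; edges = λ () ; avoids = λ () }
  embedDisjointly {n} {s} (suc ℓ) H T U budget = record
    { φ = φ ; injective = injective ; disjoint = disjoint ; on-side = on-side ; edges = edges ; avoids = avoids }
    where
      rest : ℕ
      rest = sum (λ j → size (T (suc j)))
      budget₀ : card U + size (T zero) ≤ s
      budget₀ = ≤-trans (+-monoʳ-≤ (card U) (m≤m+n (size (T zero)) rest)) budget
      module E₀ = TreeEmbedding.Embedding (TreeEmbedding.embed (H zero) (T zero) U budget₀)
      budget₁ : card E₀.used + rest ≤ s
      budget₁ = subst (_≤ s) (trans (sym (+-assoc (card U) _ _)) (cong (_+ rest) (sym E₀.card-used))) budget
      module R = DisjointEmbeddings (embedDisjointly ℓ (H ∘ suc) (T ∘ suc) E₀.used budget₁)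

      φ : (j : Fin (suc ℓ)) → Fin (size (T j)) → Fin n
      φ zero    = E₀.φ
      φ (suc j) = R.φ j
      injective : ∀ j a b → φ j a ≡ φ j b → a ≡ b
      injective zero    = E₀.injective
      injective (suc j) = R.injective j
      first≢rest : ∀ j a b → E₀.φ a ≢ R.φ j b
      first≢rest j a b e = not-¬ (E₀.image⊆used a) (trans (cong E₀.used e) (R.avoids j b))
      disjoint : ∀ j j' a b → j ≢ j' → φ j a ≢ φ j' b
      disjoint zero    zero     a b j≢j' = ⊥-elim (j≢j' refl)
      disjoint zero    (suc j') a b _    = first≢rest j' a b
      disjoint (suc j) zero     a b _    = first≢rest j b a ∘ sym
      disjoint (suc j) (suc j') a b j≢j' = R.disjoint j j' a b (j≢j' ∘ cong suc)
      on-side : ∀ j a → Host.alive (H j) (inA (T j) a) (φ j a) ≡ true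
      on-side zero    = E₀.on-side
      on-side (suc j) = R.on-side j
      edges : ∀ j a b → Adj (T j) a b → Host.link (H j) (inA (T j) a) (φ j a) (φ j b) ≡ true
      edges zero    = E₀.edges
      edges (suc j) = R.edges j
      avoids : ∀ j a → U (φ j a) ≡ false
      avoids zero      = E₀.avoids
      avoids (suc j) a = ¬-not (λ Ua → not-¬ (E₀.U⊆used _ Ua) (R.avoids j a))


module DoubleCover where

  open Counting
  open DenseSubgraphs
  open BipartiteHosts
  open import Data.Nat using (ℕ; _+_; _*_; _≤_; _<_)
  open import Data.Nat.Properties hiding (_≟_)
  open import Data.Nat.Tactic.RingSolver using (solve-∀)
  open import Data.Bool using (Bool; true; false; _∧_; not)
  open import Data.Fin using (Fin; _↑ˡ_; _↑ʳ_; splitAt; join)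
  open import Data.Fin.Properties using (splitAt-↑ˡ; splitAt-↑ʳ; join-splitAt)
  open import Data.Empty using (⊥-elim)
  open import Data.Bool.Properties using (not-¬)
  open import Data.Product using (Σ; _×_; _,_; proj₁; proj₂)
  open import Data.Sum using (_⊎_; inj₁; inj₂)
  open import Function using (_∘_)
  open import Relation.Binary.PropositionalEquality
  open import Algebra.Properties.CommutativeMonoid.Sum +-0-commutativeMonoid
    using (sum; sum-cong-≗; ∑-comm)

  -- A relation A with many arcs compared with the set K of their endpoints,
  -- 2s|K| < |A|, yields a host: a subgraph of minimum degree ≥ s of the bipartite
  -- double cover of A, in which v on side true is linked to u on side false iff A v u.
  module HostFromArcs {n : ℕ} (A : Fin n → Fin n → Bool) (K : Fin n → Bool)
                      (A⊆K : ∀ v u → A v u ≡ true → K v ≡ true × K u ≡ true) (s : ℕ) where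

    coverArc : Fin n ⊎ Fin n → Fin n ⊎ Fin n → Bool
    coverArc (inj₁ v) (inj₂ u) = A v u
    coverArc (inj₂ v) (inj₁ u) = A u v
    coverArc (inj₁ _) (inj₁ _) = false
    coverArc (inj₂ _) (inj₂ _) = false

    coverArc-sym : ∀ x y → coverArc x y ≡ coverArc y x
    coverArc-sym (inj₁ v) (inj₂ u) = refl
    coverArc-sym (inj₂ v) (inj₁ u) = refl
    coverArc-sym (inj₁ _) (inj₁ _) = refl
    coverArc-sym (inj₂ _) (inj₂ _) = refl

    R : Fin (n + n) → Fin (n + n) → Bool
    R h h' = coverArc (splitAt n h) (splitAt n h')

    base : Fin n ⊎ Fin n → Fin n
    base (inj₁ v) = v
    base (inj₂ v) = v

    K₂ : Fin (n + n) → Bool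
    K₂ h = K (base (splitAt n h))

    coverArc⊆K : ∀ x y → coverArc x y ≡ true → K (base y) ≡ true
    coverArc⊆K (inj₁ v) (inj₂ u) a = proj₂ (A⊆K v u a)
    coverArc⊆K (inj₂ v) (inj₁ u) a = proj₁ (A⊆K u v a)

    open MinDegree R (λ h h' → coverArc-sym (splitAt n h) (splitAt n h')) s

    -- every R-neighbour lies in K₂, so inside K₂ degrees are full degrees
    deg-K₂ : ∀ h → deg K₂ h ≡ sum (λ h' → 𝟙 (R h h'))
    deg-K₂ h = sum-cong-≗ λ h' → absorb (K₂ h') (R h h') (coverArc⊆K (splitAt n h) (splitAt n h'))
      where
        absorb : ∀ a c → (c ≡ true → a ≡ true) → 𝟙 a * 𝟙 c ≡ 𝟙 c
        absorb a false _ = *-zeroʳ (𝟙 a)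
        absorb a true  c⇒a rewrite c⇒a refl = refl

    outside-K₂ : ∀ h h' → K₂ h ≡ false → R h h' ≡ false
    outside-K₂ h h' K₂h with R h h' in arc
    ... | false = refl
    ... | true  = ⊥-elim (not-¬ (coverArc⊆K (splitAt n h') (splitAt n h) (trans (coverArc-sym (splitAt n h') (splitAt n h)) arc)) K₂h)

    left-degree : ∀ v → sum (λ h' → 𝟙 (coverArc (inj₁ v) (splitAt n h'))) ≡ sum (λ u → 𝟙 (A v u))
    left-degree v = trans (sum-splitAt n (λ y → 𝟙 (coverArc (inj₁ v) y))) (cong (_+ sum (λ u → 𝟙 (A v u))) (sum-zero {n} λ _ → refl))

    right-degree : ∀ v → sum (λ h' → 𝟙 (coverArc (inj₂ v) (splitAt n h'))) ≡ sum (λ u → 𝟙 (A u v))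
    right-degree v = trans (sum-splitAt n (λ y → 𝟙 (coverArc (inj₂ v) y)))
                           (trans (cong (sum (λ u → 𝟙 (A u v)) +_) (sum-zero {n} λ _ → refl)) (+-identityʳ _))

    -- every arc is counted once from each of its two copies
    degSum-K₂ : degSum K₂ ≡ arcCount A + arcCount A
    degSum-K₂ = begin
        degSum K₂
      ≡⟨ sum-cong-≗ (λ h → trans (cong (𝟙 (K₂ h) *_) (deg-K₂ h)) (restrict h (K₂ h) refl)) ⟩
        sum (λ h → sum (λ h' → 𝟙 (R h h')))
      ≡⟨ sum-splitAt n (λ x → sum (λ h' → 𝟙 (coverArc x (splitAt n h')))) ⟩
        sum (λ v → sum (λ h' → 𝟙 (coverArc (inj₁ v) (splitAt n h')))) + sum (λ v → sum (λ h' → 𝟙 (coverArc (inj₂ v) (splitAt n h'))))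
      ≡⟨ cong₂ _+_ (sum-cong-≗ left-degree) (sum-cong-≗ right-degree) ⟩
        arcCount A + sum (λ v → sum (λ u → 𝟙 (A u v)))
      ≡⟨ cong (arcCount A +_) (∑-comm (λ v u → 𝟙 (A u v))) ⟩
        arcCount A + arcCount A
      ∎
      where
        open ≡-Reasoning
        restrict : ∀ h b → K₂ h ≡ b → 𝟙 b * sum (λ h' → 𝟙 (R h h')) ≡ sum (λ h' → 𝟙 (R h h'))
        restrict h true  _   = +-identityʳ _
        restrict h false K₂h = sym (sum-zero (λ h' → cong 𝟙 (outside-K₂ h h' K₂h)))

    card-K₂ : card K₂ ≡ card K + card K
    card-K₂ = sum-splitAt n (𝟙 ∘ K ∘ base)

    dense-K₂ : 2 * s * card K < arcCount A → Dense K₂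
    dense-K₂ many = begin-strict
        s * card K₂ + s * card K₂                     ≡⟨ cong (λ c → s * c + s * c) card-K₂ ⟩
        s * (k + k) + s * (k + k)                     ≡⟨ regroup s k ⟩
        2 * s * k + 2 * s * k                         <⟨ +-mono-< many many ⟩
        arcCount A + arcCount A                       ≤⟨ m≤m+n _ _ ⟩
        arcCount A + arcCount A + (card K₂ + card K₂) ≡⟨ cong (_+ (card K₂ + card K₂)) degSum-K₂ ⟨
        degSum K₂ + (card K₂ + card K₂)               ∎
      where
        open ≤-Reasoning
        k : ℕ
        k = card K
        regroup : ∀ s k → s * (k + k) + s * (k + k) ≡ 2 * s * k + 2 * s * k
        regroup = solve-∀

    cover : Bool → Fin n → Fin (n + n)
    cover true  v = v ↑ˡ n
    cover false v = n ↑ʳ v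

    every-copy : ∀ h → Σ Bool λ b → Σ (Fin n) λ v → cover b v ≡ h
    every-copy h with splitAt n h in split
    ... | inj₁ v = true  , v , trans (cong (join n n) (sym split)) (join-splitAt n n h)
    ... | inj₂ v = false , v , trans (cong (join n n) (sym split)) (join-splitAt n n h)

    linkA : Bool → Fin n → Fin n → Bool
    linkA true  v u = A v u
    linkA false v u = A u v

    module Construction (many : 2 * s * card K < arcCount A) where

      -- only the properties of the subgraph matter, not how it was found
      opaque
        subgraph : MinDegreeSubgraph
        subgraph = minDegreeSubgraph K₂ (dense-K₂ many)

      W : Fin (n + n) → Bool
      W = proj₁ subgraph

      alive : Bool → Fin n → Bool
      alive b v = W (cover b v)

      no-arc : ∀ h h' → R h h' ≡ false → 𝟙 (W h') * 𝟙 (R h h') ≡ 0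
      no-arc h h' no rewrite no = *-zeroʳ (𝟙 (W h'))

      arc-weight : ∀ h h' c → R h h' ≡ c → 𝟙 (W h') * 𝟙 (R h h') ≡ 𝟙 (W h' ∧ c)
      arc-weight h h' c R≡c rewrite R≡c = 𝟙-∧ (W h') c

      deg-cover : ∀ b v → deg W (cover b v) ≡ card (λ u → alive (not b) u ∧ linkA b v u)
      deg-cover true v = trans (sum-↑ n (λ h → 𝟙 (W h) * 𝟙 (R (v ↑ˡ n) h)))
        (cong₂ _+_ (sum-zero {n} (λ u → no-arc _ _ (cong₂ coverArc (splitAt-↑ˡ n v n) (splitAt-↑ˡ n u n))))
                   (sum-cong-≗ (λ u → arc-weight _ _ _ (cong₂ coverArc (splitAt-↑ˡ n v n) (splitAt-↑ʳ n n u)))))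
      deg-cover false v = trans (sum-↑ n (λ h → 𝟙 (W h) * 𝟙 (R (n ↑ʳ v) h)))
        (trans (cong₂ _+_ (sum-cong-≗ (λ u → arc-weight _ _ _ (cong₂ coverArc (splitAt-↑ʳ n n v) (splitAt-↑ˡ n u n))))
                          (sum-zero {n} (λ u → no-arc _ _ (cong₂ coverArc (splitAt-↑ʳ n n v) (splitAt-↑ʳ n n u)))))
               (+-identityʳ _))

      host : Host n s
      host = record
        { alive = alive
        ; link = linkA
        ; link-sym = λ { true v u → refl ; false v u → refl }
        ; minDegree = λ b v alive-v → subst (s ≤_) (deg-cover b v) (proj₂ (proj₂ subgraph) (cover b v) alive-v)
        ; someAlive = someAlive
        }
        where
          someAlive : Σ Bool λ b → Σ (Fin n) λ v → alive b v ≡ true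
          someAlive with proj₁ (proj₂ subgraph)
          ... | h , Wh with every-copy h
          ...   | b , v , refl = b , v , Wh


module Orientations where

  open import Defs hiding (sym)
  open Counting
  open import Data.Nat using (ℕ; _+_; _≤_; z≤n; s≤s)
  open import Data.Nat.Properties using (m≤n+m; m≤m+n; ≤-trans)
  open import Data.Bool using (Bool; true; false; _∧_; _∨_; not)
  open import Data.Bool.Properties using (not-injective)
  open import Data.Fin using (Fin; _≟_)
  open import Data.Fin.Subset using (Subset)
  open import Data.Vec.Functional using (updateAt)
  open import Data.Vec.Functional.Properties using (updateAt-updates; updateAt-minimal)
  open import Data.Product using (_×_; _,_; proj₁; proj₂)
  open import Data.Sum using (inj₁; inj₂; [_,_]′)
  open import Function using (const)
  open import Relation.Nullary using (yes; no)
  open import Relation.Binary.PropositionalEquality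

  module GoodEdgeSets {n r ℓ : ℕ} (G : Graph n) (X : Subset n) (S : Family n r ℓ) (E : Fin ℓ → EdgeSetIn G X)
    (good : ∀ (x y : Fin ℓ → Fin n) → (∀ i → mem (E i) (x i) (y i) ≡ true) → ∀ i → EdgeTo G i (x i) (y i) S)
    (x₀ y₀ : Fin ℓ → Fin n) (e₀ : ∀ j → mem (E j) (x₀ j) (y₀ j) ≡ true) where

    -- every single edge vu of E_i satisfies vu →ᵢ S: complete it by the fixed edges of the other E_j
    edgeTo : ∀ i {v u} → mem (E i) v u ≡ true → EdgeTo G i v u S
    edgeTo i {v} {u} vu∈ = subst₂ (λ a b → EdgeTo G i a b S) (updateAt-updates i x₀) (updateAt-updates i y₀)
                             (good x y all∈ i)
      where
        x y : Fin ℓ → Fin n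
        x = updateAt x₀ i (const v)
        y = updateAt y₀ i (const u)
        all∈ : ∀ j → mem (E j) (x j) (y j) ≡ true
        all∈ j with j ≟ i
        ... | yes refl rewrite updateAt-updates j {const v} x₀ | updateAt-updates j {const u} y₀ = vu∈
        ... | no  j≢i  rewrite updateAt-minimal j i {const v} x₀ j≢i | updateAt-minimal j i {const u} y₀ j≢i = e₀ j

    module Orientation (i : Fin ℓ) where

      forwardIf : ∀ v u b → mem (E i) v u ≡ b → Bool
      forwardIf v u true  vu∈ = [ const true , const false ]′ (edgeTo i vu∈)
      forwardIf v u false _   = false

      forward : Fin n → Fin n → Bool
      forward v u = forwardIf v u (mem (E i) v u) refl

      forward-sound : ∀ v u → forward v u ≡ true → mem (E i) v u ≡ true × PairTo G i v u S
      forward-sound v u = go (mem (E i) v u) refl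
        where
          go : ∀ b (vu∈ : mem (E i) v u ≡ b) → forwardIf v u b vu∈ ≡ true → mem (E i) v u ≡ true × PairTo G i v u S
          go true vu∈ fwd with edgeTo i vu∈
          ... | inj₁ p = vu∈ , p

      backward-sound : ∀ v u → mem (E i) u v ≡ true → forward u v ≡ false → PairTo G i v u S
      backward-sound v u uv∈ = go (mem (E i) u v) refl uv∈
        where
          go : ∀ b (uv∈ : mem (E i) u v ≡ b) → b ≡ true → forwardIf u v b uv∈ ≡ false → PairTo G i v u S
          go true uv∈ _ bwd with edgeTo i uv∈
          ... | inj₂ p = p

      arc : Fin n → Fin n → Bool
      arc v u = forward v u ∨ (mem (E i) v u ∧ not (forward u v))

      arc-sound : ∀ v u → arc v u ≡ true → mem (E i) v u ≡ true × PairTo G i v u S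
      arc-sound v u a with forward v u in fwd
      ... | true  = forward-sound v u fwd
      ... | false = vu∈ , backward-sound v u (trans (msym (E i) u v) vu∈) (not-injective (proj₂ (∧-true a)))
        where vu∈ = proj₁ (∧-true a)

      arc-covers : ∀ v u → 𝟙 (mem (E i) v u) ≤ 𝟙 (arc v u) + 𝟙 (arc u v)
      arc-covers v u with forward u v
      ... | true  = ≤-trans (𝟙≤1 (mem (E i) v u)) (m≤n+m 1 _)
      ... | false = ≤-trans (covers (forward v u) (mem (E i) v u)) (m≤m+n _ _)
        where
          covers : ∀ a b → 𝟙 b ≤ 𝟙 (a ∨ (b ∧ true))
          covers true  b     = 𝟙≤1 b
          covers false true  = s≤s z≤n
          covers false false = z≤n


module ZykovCopies where

  open import Defs hiding (sym)
  open import Data.Nat using (ℕ; zero; suc)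
  open import Data.Bool using (Bool; true; false)
  import Data.Bool.Properties as Bool
  open import Data.Fin using (Fin; zero; suc; _≟_)
  open import Data.Fin.Properties using (suc-injective)
  open import Data.Fin.Subset using (Subset; _∈_; _⊆_; ∣_∣)
  open import Data.Vec using ([]; _∷_; here; there)
  import Data.Vec.Properties as Vec
  open import Data.Product using (Σ; _×_; _,_; proj₁; proj₂)
  open import Data.Empty using (⊥; ⊥-elim)
  open import Relation.Nullary using (Dec; yes; no)
  open import Relation.Binary.PropositionalEquality
  open import Function using (_∘_)

  Enumeration : ∀ {n} → Subset n → ℕ → Set
  Enumeration {n} P t = Σ (Fin t → Fin n) λ f → (∀ a b → f a ≡ f b → a ≡ b) × (∀ a → f a ∈ P)

  enumerate : ∀ {n} (P : Subset n) → Enumeration P ∣ P ∣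
  enumerate []          = (λ ()) , (λ ()) , (λ ())
  enumerate (true ∷ P)  with enumerate P
  ... | f , f-inj , f∈ = f' , f'-inj , f'∈
    where
      f' : Fin (suc ∣ P ∣) → Fin _
      f' zero    = zero
      f' (suc a) = suc (f a)
      f'-inj : ∀ a b → f' a ≡ f' b → a ≡ b
      f'-inj zero    zero    _ = refl
      f'-inj (suc a) (suc b) e = cong suc (f-inj a b (suc-injective e))
      f'∈ : ∀ a → f' a ∈ (true ∷ P)
      f'∈ zero    = here
      f'∈ (suc a) = there (f∈ a)
  enumerate (false ∷ P) with enumerate P
  ... | f , f-inj , f∈ = suc ∘ f , (λ a b e → f-inj a b (suc-injective e)) , there ∘ f∈

  record TreeCopies {n r ℓ : ℕ} (G : Graph n) (X : Subset n) (S : Family n r ℓ) (T : Fin ℓ → Tree) : Set where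
    field
      φ         : (j : Fin ℓ) → Fin (size (T j)) → Fin n
      injective : ∀ j a b → φ j a ≡ φ j b → a ≡ b
      disjoint  : ∀ j j' a b → j ≢ j' → φ j a ≢ φ j' b
      edges     : ∀ j a b → Adj (T j) a b → Adj G (φ j a) (φ j b)
      inX       : ∀ j a → φ j a ∈ X
      nbhd-W    : ∀ j a i → InNbhd G (SW S i) (φ j a)
      nbhd-U    : ∀ j a I → UAdj T I j a → InNbhd G (SI S I) (φ j a)

  module ZykovMap {n r ℓ t : ℕ} {G : Graph n} {X : Subset n} {S : Family n r ℓ} {T : Fin ℓ → Tree}
    (copies : TreeCopies G X S T) (enumI : ∀ I → Enumeration (SI S I) t) (enumW : ∀ i → Enumeration (SW S i) t) where

    open TreeCopies copies

    eI : ∀ I → Fin t → Fin n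
    eI I = proj₁ (enumI I)
    eI∈ : ∀ I a → eI I a ∈ SI S I
    eI∈ I = proj₂ (proj₂ (enumI I))
    eW : ∀ i → Fin t → Fin n
    eW i = proj₁ (enumW i)
    eW∈ : ∀ i a → eW i a ∈ SW S i
    eW∈ i = proj₂ (proj₂ (enumW i))

    f : ZV r ℓ t T → Fin n
    f (tv j a) = φ j a
    f (uv I a) = eI I a
    f (wv i a) = eW i a

    f-injective : ∀ (Y : Subset n) → (∀ v → v ∈ X → v ∈ Y → ⊥) → (∀ I → SI S I ⊆ Y) → (∀ i → SW S i ⊆ Y) →
      (∀ I I' → I ≢ I' → Disj (SI S I) (SI S I')) → (∀ i i' → i ≢ i' → Disj (SW S i) (SW S i')) →
      (∀ I i → Disj (SI S I) (SW S i)) → ∀ x y → f x ≡ f y → x ≡ y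
    f-injective Y X∩Y=∅ SI⊆Y SW⊆Y disjI disjW disjIW = f-inj
      where
        tree≢I : ∀ j a I b → φ j a ≢ eI I b
        tree≢I j a I b e = X∩Y=∅ _ (inX j a) (subst (_∈ Y) (sym e) (SI⊆Y I (eI∈ I b)))
        tree≢W : ∀ j a i b → φ j a ≢ eW i b
        tree≢W j a i b e = X∩Y=∅ _ (inX j a) (subst (_∈ Y) (sym e) (SW⊆Y i (eW∈ i b)))
        I≢W : ∀ I a i b → eI I a ≢ eW i b
        I≢W I a i b e = disjIW I i _ (eI∈ I a) (subst (_∈ SW S i) (sym e) (eW∈ i b))
        tree-inj : ∀ j j' a a' → Dec (j ≡ j') → φ j a ≡ φ j' a' → tv {r} {ℓ} {t} {T} j a ≡ tv j' a'
        tree-inj j .j a a' (yes refl) e = cong (tv j) (injective j a a' e)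
        tree-inj j j' a a' (no j≢j')  e = ⊥-elim (disjoint j j' a a' j≢j' e)
        I-inj : ∀ I I' a a' → Dec (I ≡ I') → eI I a ≡ eI I' a' → uv {r} {ℓ} {t} {T} I a ≡ uv I' a'
        I-inj I .I a a' (yes refl) e = cong (uv I) (proj₁ (proj₂ (enumI I)) a a' e)
        I-inj I I' a a' (no I≢I')  e = ⊥-elim (disjI I I' I≢I' _ (eI∈ I a) (subst (_∈ SI S I') (sym e) (eI∈ I' a')))
        W-inj : ∀ i i' a a' → Dec (i ≡ i') → eW i a ≡ eW i' a' → wv {r} {ℓ} {t} {T} i a ≡ wv i' a'
        W-inj i .i a a' (yes refl) e = cong (wv i) (proj₁ (proj₂ (enumW i)) a a' e)
        W-inj i i' a a' (no i≢i')  e = ⊥-elim (disjW i i' i≢i' _ (eW∈ i a) (subst (_∈ SW S i') (sym e) (eW∈ i' a')))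
        f-inj : ∀ x y → f x ≡ f y → x ≡ y
        f-inj (tv j a) (tv j' a') e = tree-inj j j' a a' (j ≟ j') e
        f-inj (tv j a) (uv I b)   e = ⊥-elim (tree≢I j a I b e)
        f-inj (tv j a) (wv i b)   e = ⊥-elim (tree≢W j a i b e)
        f-inj (uv I b) (tv j a)   e = ⊥-elim (tree≢I j a I b (sym e))
        f-inj (wv i b) (tv j a)   e = ⊥-elim (tree≢W j a i b (sym e))
        f-inj (uv I a) (uv I' a') e = I-inj I I' a a' (Vec.≡-dec Bool._≟_ I I') e
        f-inj (uv I a) (wv i b)   e = ⊥-elim (I≢W I a i b e)
        f-inj (wv i b) (uv I a)   e = ⊥-elim (I≢W I a i b (sym e))
        f-inj (wv i a) (wv i' a') e = W-inj i i' a a' (i ≟ i') e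

    f-adjacent : (∀ I i → Joined G (SI S I) (SW S i)) → (∀ i i' → i ≢ i' → Joined G (SW S i) (SW S i')) →
      ∀ x y → ZAdj x y → Adj G (f x) (f y)
    f-adjacent joinIW joinWW (tv j a) (tv .j b) (tt-adj ab)   = edges j a b ab
    f-adjacent joinIW joinWW (uv I b) (tv j a)  (ut-adj adj)  = Graph.sym G (nbhd-U j a I adj _ (eI∈ I b))
    f-adjacent joinIW joinWW (tv j a) (uv I b)  (tu-adj adj)  = nbhd-U j a I adj _ (eI∈ I b)
    f-adjacent joinIW joinWW (wv i b) (tv j a)  wt-adj        = Graph.sym G (nbhd-W j a i _ (eW∈ i b))
    f-adjacent joinIW joinWW (tv j a) (wv i b)  tw-adj        = nbhd-W j a i _ (eW∈ i b)
    f-adjacent joinIW joinWW (wv i a) (uv I b)  wu-adj        = Graph.sym G (joinIW I i _ _ (eI∈ I b) (eW∈ i a))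
    f-adjacent joinIW joinWW (uv I b) (wv i a)  uw-adj        = joinIW I i _ _ (eI∈ I b) (eW∈ i a)
    f-adjacent joinIW joinWW (wv i a) (wv i' b) (ww-adj i≢i') = joinWW i i' i≢i' _ _ (eW∈ i a) (eW∈ i' b)

  zykovCopy : ∀ {n r ℓ t} (G : Graph n) (X Y : Subset n) → (∀ v → v ∈ X → v ∈ Y → ⊥) →
    (T : Fin ℓ → Tree) (S : Family n r ℓ) → InF G r ℓ t Y S → TreeCopies G X S T → ContainsZ G r ℓ t T
  zykovCopy G X Y X∩Y=∅ T S (sizeI , sizeW , SI⊆Y , SW⊆Y , disjI , disjW , disjIW , joinIW , joinWW) copies =
    f , f-injective Y X∩Y=∅ SI⊆Y SW⊆Y disjI disjW disjIW , f-adjacent joinIW joinWW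
    where
      open ZykovMap copies (λ I → subst (Enumeration (SI S I)) (sizeI I) (enumerate (SI S I)))
                           (λ i → subst (Enumeration (SW S i)) (sizeW i) (enumerate (SW S i)))


module OrientedHosts where

  open import Defs hiding (sym)
  open Counting
  open BipartiteHosts using (Host; module HostProperties; DisjointEmbeddings)
  open ZykovCopies using (TreeCopies)
  open DoubleCover
  open Orientations
  open import Data.Nat using (ℕ; _+_; _*_; _≤_; _<_; z≤n; s≤s; >-nonZero)
  open import Data.Nat.Tactic.RingSolver using (solve-∀)
  open import Data.Nat.Properties hiding (_≟_)
  open import Data.Bool using (Bool; true; false)
  open import Data.Fin using (Fin)
  open import Data.Fin.Subset using (Subset; _∈_; _∉_)
  open import Data.Sum using (_⊎_; inj₁; inj₂)
  open import Data.Product using (_×_; _,_; proj₁; proj₂)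
  open import Relation.Binary.PropositionalEquality
  open import Algebra.Properties.CommutativeMonoid.Sum +-0-commutativeMonoid
    using (sum; sum-cong-≗; ∑-distrib-+; ∑-comm)

  module HostsFromGoodEdgeSets {n r ℓ : ℕ} (G : Graph n) (X : Subset n) (S : Family n r ℓ) (E : Fin ℓ → EdgeSetIn G X)
    (good : ∀ (x y : Fin ℓ → Fin n) → (∀ i → mem (E i) (x i) (y i) ≡ true) → ∀ i → EdgeTo G i (x i) (y i) S)
    (x₀ y₀ : Fin ℓ → Fin n) (e₀ : ∀ j → mem (E j) (x₀ j) (y₀ j) ≡ true) (i : Fin ℓ) where

    open GoodEdgeSets G X S E good x₀ y₀ e₀
    open Orientation i public

    spanned : Fin n → Bool
    spanned v = any (mem (E i) v)

    arc⊆spanned : ∀ v u → arc v u ≡ true → spanned v ≡ true × spanned u ≡ true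
    arc⊆spanned v u a = any-intro (mem (E i) v) u vu∈ , any-intro (mem (E i) u) v (trans (msym (E i) u v) vu∈)
      where
        vu∈ : mem (E i) v u ≡ true
        vu∈ = proj₁ (arc-sound v u a)

    degreeSum≤arcs : sumF (degE (E i)) ≤ arcCount arc + arcCount arc
    degreeSum≤arcs = begin
        sumF (degE (E i))
      ≡⟨ trans (sumF≡sum (degE (E i))) (sum-cong-≗ (λ v → count≡card (mem (E i) v))) ⟩
        sum (λ v → sum (λ u → 𝟙 (mem (E i) v u)))
      ≤⟨ sum-mono (λ v → sum-mono (λ u → arc-covers v u)) ⟩
        sum (λ v → sum (λ u → 𝟙 (arc v u) + 𝟙 (arc u v)))
      ≡⟨ sum-cong-≗ (λ v → ∑-distrib-+ (λ u → 𝟙 (arc v u)) (λ u → 𝟙 (arc u v))) ⟩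
        sum (λ v → sum (λ u → 𝟙 (arc v u)) + sum (λ u → 𝟙 (arc u v)))
      ≡⟨ ∑-distrib-+ (λ v → sum (λ u → 𝟙 (arc v u))) (λ v → sum (λ u → 𝟙 (arc u v))) ⟩
        arcCount arc + sum (λ v → sum (λ u → 𝟙 (arc u v)))
      ≡⟨ cong (arcCount arc +_) (∑-comm (λ v u → 𝟙 (arc u v))) ⟩
        arcCount arc + arcCount arc
      ∎
      where open ≤-Reasoning

    many-arcs : ∀ s → 1 ≤ s → 0 < vertsE (E i) → 8 * s * vertsE (E i) ≤ sumF (degE (E i)) →
                2 * s * card spanned < arcCount arc
    many-arcs s 1≤s V>0 dense = *-cancelˡ-< 2 _ _ (begin-strict
        2 * (2 * s * card spanned)  ≡⟨ cong (λ V → 2 * (2 * s * V)) (sym (count≡card spanned)) ⟩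
        2 * (2 * s * V)             ≡⟨ regroup s V ⟩
        4 * (s * V)                 <⟨ *-monoˡ-< (s * V) {{>-nonZero (*-mono-≤ 1≤s V>0)}} {4} {8} (m<m+n 4 (s≤s z≤n)) ⟩
        8 * (s * V)                 ≡⟨ sym (*-assoc 8 s V) ⟩
        8 * s * V                   ≤⟨ dense ⟩
        sumF (degE (E i))           ≤⟨ degreeSum≤arcs ⟩
        arcCount arc + arcCount arc ≡⟨ cong (arcCount arc +_) (sym (+-identityʳ _)) ⟩
        2 * arcCount arc            ∎)
      where
        open ≤-Reasoning
        V : ℕ
        V = vertsE (E i)
        regroup : ∀ s V → 2 * (2 * s * V) ≡ 4 * (s * V)
        regroup = solve-∀

    host : ∀ s → 2 * s * card spanned < arcCount arc → Host n s
    host s many = HostFromArcs.Construction.host arc spanned arc⊆spanned s many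

    -- What a vertex of E_i on side b is joined to: the blown-up vertices w_j, and u_I
    -- for i ∈ I (side true) or i ∉ I (side false); this is the neighbourhood of u_I
    -- required of a tree vertex in A_i (side true) or B_i (side false).
    SideNbhd : Bool → Fin n → Set
    SideNbhd b v = v ∈ X × (∀ j → InNbhd G (SW S j) v) ×
                   (∀ I → (i ∈ I × b ≡ true) ⊎ (i ∉ I × b ≡ false) → InNbhd G (SI S I) v)

    linked-nbhd : ∀ s (many : 2 * s * card spanned < arcCount arc) b v u →
                  Host.link (host s many) b v u ≡ true → SideNbhd b v
    linked-nbhd s many true v u arc-vu with arc-sound v u arc-vu
    ... | vu∈ , to-W , to-I , _ =
      proj₁ (proj₂ (sound (E i) v u vu∈)) , (λ j → proj₁ (to-W j)) , λ { I (inj₁ (i∈I , _)) → to-I I i∈I }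
    linked-nbhd s many false v u arc-uv with arc-sound u v arc-uv
    ... | uv∈ , to-W , _ , to-I =
      proj₂ (proj₂ (sound (E i) u v uv∈)) , (λ j → proj₂ (to-W j)) , λ { I (inj₂ (i∉I , _)) → to-I I i∉I }

    link-adjacent : ∀ s (many : 2 * s * card spanned < arcCount arc) b v u →
                    Host.link (host s many) b v u ≡ true → Adj G v u
    link-adjacent s many true  v u arc-vu = proj₁ (sound (E i) v u (proj₁ (arc-sound v u arc-vu)))
    link-adjacent s many false v u arc-uv = Graph.sym G (proj₁ (sound (E i) u v (proj₁ (arc-sound u v arc-uv))))

    alive-nbhd : ∀ s (many : 2 * s * card spanned < arcCount arc) → 1 ≤ s → ∀ b v →
                 Host.alive (host s many) b v ≡ true → SideNbhd b v
    alive-nbhd s many 1≤s b v alive-v with HostProperties.neighbour (host s many) 1≤s b v alive-v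
    ... | u , _ , vu = linked-nbhd s many b v u vu

  module CopiesFromHosts {n r ℓ : ℕ} (G : Graph n) (X : Subset n) (S : Family n r ℓ) (E : Fin ℓ → EdgeSetIn G X)
    (good : ∀ (x y : Fin ℓ → Fin n) → (∀ i → mem (E i) (x i) (y i) ≡ true) → ∀ i → EdgeTo G i (x i) (y i) S)
    (x₀ y₀ : Fin ℓ → Fin n) (e₀ : ∀ j → mem (E j) (x₀ j) (y₀ j) ≡ true) where

    module Hosts (j : Fin ℓ) = HostsFromGoodEdgeSets G X S E good x₀ y₀ e₀ j
    open Hosts public

    copies : ∀ s (many : ∀ j → 2 * s * card (spanned j) < arcCount (arc j)) → (∀ j → 1 ≤ s) →
             (T : Fin ℓ → Tree) (U : Fin n → Bool) → DisjointEmbeddings (λ j → host j s (many j)) T U → TreeCopies G X S T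
    copies s many 1≤s T U embeddings = record
      { φ = φ ; injective = injective ; disjoint = disjoint
      ; edges = λ j a b ab → link-adjacent j s (many j) (inA (T j) a) _ _ (edges j a b ab)
      ; inX = λ j a → proj₁ (nbhd j a)
      ; nbhd-W = λ j a → proj₁ (proj₂ (nbhd j a))
      ; nbhd-U = λ j a → proj₂ (proj₂ (nbhd j a)) }
      where
        open DisjointEmbeddings embeddings
        nbhd : ∀ j a → SideNbhd j (inA (T j) a) (φ j a)
        nbhd j a = alive-nbhd j s (many j) (1≤s j) _ _ (on-side j a)


open Counting using (card; arcCount; sum-zero; sumF≡sum; term≤sum; someEdge)
open AverageDegree using (averageDegreeBound)
open BipartiteHosts using (Host; embedDisjointly)
open OrientedHosts using (module CopiesFromHosts)
open ZykovCopies using (zykovCopy)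
import Data.Nat as ℕ
open import Data.Nat.Properties using (≤-trans; ≤-reflexive; +-0-commutativeMonoid)
open import Data.Bool using (Bool; false)
open import Data.Product using (_×_; _,_; proj₁; proj₂)
open import Relation.Binary.PropositionalEquality using (refl; cong₂) renaming (sym to ≡-sym)
open import Algebra.Properties.CommutativeMonoid.Sum +-0-commutativeMonoid using (sum)

open import Defs
open import Data.Nat using (ℕ; _≤_; _+_; _^_)
open import Data.Rational using (ℚ; 0ℚ; _*_; _>_) renaming (_≤_ to _≤ℚ_)
open import Data.Fin using (Fin)
open import Data.Fin.Subset using (Subset; _∈_)
open import Data.Product using (Σ)
open import Data.Empty using (⊥)

lemma5p7 : ∀ {n} (G : Graph n) (X Y : Subset n) → (∀ v → v ∈ X → v ∈ Y → ⊥) →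
    (r ℓ t : ℕ) → 3 ≤ r → (α : ℚ) (αpos : α > 0ℚ) → (T : Fin ℓ → Tree) → (C : ℚ) →
    ℕtoℚ (2 ^ (ℓ + 3)) * invPos α αpos * ℕtoℚ (sumF (λ i → size (T i))) ≤ℚ C →
    (S : Family n r ℓ) → InF G r ℓ t Y S → Good G r ℓ t C α X Y S →
    ContainsZ G r ℓ t T
lemma5p7 {n} G X Y X∩Y=∅ r ℓ t _ α αpos T C C-large S S∈F (E , dense , good) =
  zykovCopy G X Y X∩Y=∅ T S S∈F (copies s many 1≤s T noVertex (embedDisjointly ℓ hosts T noVertex budget))
  where
    s : ℕ
    s = sumF (λ j → size (T j))
    1≤s : Fin ℓ → 1 ≤ s
    1≤s j = ≤-trans (nonempty (T j)) (≤-trans (term≤sum (λ i → size (T i)) j) (≤-reflexive (≡-sym (sumF≡sum (λ i → size (T i))))))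
    bound : ∀ j → 0 ℕ.< vertsE (E j) × 8 ℕ.* s ℕ.* vertsE (E j) ≤ sumF (degE (E j))
    bound j = averageDegreeBound ℓ α αpos C s (1≤s j) C-large (E j) (dense j)
    -- a fixed edge x₀ⱼy₀ⱼ of each E_j, with which goodness orients every edge of E_j
    x₀ y₀ : Fin ℓ → Fin n
    x₀ j = proj₁ (someEdge (E j) (proj₁ (bound j)))
    y₀ j = proj₁ (proj₂ (someEdge (E j) (proj₁ (bound j))))
    open CopiesFromHosts G X S E good x₀ y₀ (λ j → proj₂ (proj₂ (someEdge (E j) (proj₁ (bound j)))))
    many : ∀ j → 2 ℕ.* s ℕ.* card (spanned j) ℕ.< arcCount (arc j)
    many j = many-arcs j s (1≤s j) (proj₁ (bound j)) (proj₂ (bound j))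
    hosts : Fin ℓ → Host n s
    hosts j = host j s (many j)
    noVertex : Fin n → Bool
    noVertex _ = false
    budget : card noVertex + sum (λ j → size (T j)) ≤ s
    budget = ≤-reflexive (cong₂ _+_ (sum-zero {n} (λ _ → refl)) (≡-sym (sumF≡sum (λ j → size (T j)))))
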